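{- Let $\lambda,\lambda'$ be partitions with at most $n$ parts. (i) Let $\beta\in U_\lambda(n)$ and $\beta'\in U_{\lambda'}(n)$. If $s_\lambda(\beta;x)=s_{\lambda'}(\beta';x)$ as polynomials in $x_1,\dots,x_n$, then $\lambda=\lambda'$. (ii) Let $\pi\in S_n^\lambda$ and $\pi'\in S_n^{\lambda'}$. If $d_\lambda(\pi;x)=d_{\lambda'}(\pi';x)$ as polynomials, then $\lambda=\lambda'$ and $\pi=\pi'$; hence $\mathcal{D}_\lambda(\pi)=\mathcal{D}_{\lambda'}(\pi')$.
   Context: Fix $n\ge1$; $[m]=\{1,\dots,m\}$, $(a,b]=\{a+1,\dots,b\}$. Partition $\lambda=(\lambda_1\ge\cdots\ge\lambda_n\ge0)$; shape boxes $(j,i)$, $1\le j\le\lambda_1$, $1\le i\le\zeta_j=\#\{i:\lambda_i\ge j\}$. $R_\lambda=\{q_1<\cdots<q_r\}\subseteq[n-1]$ is the set of column lengths less than $n$; $q_0=0$, $q_{r+1}=n$; carrels $(q_{h-1},q_h]$. $U_\lambda(n)$ is the set of $n$-tuples $\beta$ with $\beta_i\in[n]$ and $\beta_i\ge i$. $S_n^\lambda$ is the set of permutations $\pi$ of $[n]$ (written $(\pi_1,\dots,\pi_n)$) strictly increasing on each carrel of $R_\lambda$. Tableaux of shape $\lambda$: fillings $T$ with $T_j(i)\in[n]$ strictly increasing down columns, weakly along rows; $\mathcal{T}_\lambda$, ordered entrywise. Content $\Theta(T)=(\theta_1,\dots,\theta_n)$, $\theta_i$ = number of entries equal to $i$;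 $x^{\Theta(T)}=\prod x_i^{\theta_i}$. $\mathcal{S}_\lambda(\beta)=\{T\in\mathcal{T}_\lambda:T_j(i)\le\beta_i\ \forall(j,i)\}$, $s_\lambda(\beta;x)=\sum_{T\in\mathcal{S}_\lambda(\beta)}x^{\Theta(T)}$. $Y(Q)$: column with entries $Q$ increasing downward; with $B_h=\{\pi_1,\dots,\pi_{q_h}\}$, the $\lambda$-key $Y_\lambda(\pi)$ has columns left to right $\lambda_n$ copies of $Y([n])$, then for $h=r,\dots,1$, $\lambda_{q_h}-\lambda_{q_{h+1}}$ copies of $Y(B_h)$. Scanning tableau $S(T)$: EWIS of $x_1,x_2,\dots$ is $x_{i_1},x_{i_2},\dots$, $i_1=1$, $i_u$ smallest index $>i_{u-1}$ with $x_{i_u}\ge x_{i_{u-1}}$; column $j$ of $S(T)$: with columns $j,\dots,\lambda_1$ of $T$ unmarked, repeat $\zeta_j$ times: read left to right the values of the lowest unmarked boxes of columns still having unmarked boxes, take the EWIS, mark its boxes, put its last value in the lowest empty box of column $j$. $\mathcal{D}_\lambda(\pi)=\{T\in\mathcal{T}_\lambda:S(T)\le Y_\lambda(\pi)\}$, $d_\lambda(\pi;x)=\sum_{T\in\mathcal{D}_\lambda(\pi)}x^{\Theta(T)}$. -}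

module Defs where

open import Data.Nat using (ℕ; zero; suc; _+_; _∸_; _≤_; _<_; _≤ᵇ_; _<ᵇ_; _≡ᵇ_)
open import Data.Bool using (Bool; true; false; _∧_; _∨_; not; if_then_else_)
open import Data.List using (List; []; _∷_; _++_; map; concat; concatMap; replicate;
  applyUpTo; take; drop; reverse; length; filterᵇ)
open import Data.Bool.ListAction using (all; any)
open import Data.Maybe using (Maybe; just; nothing; fromMaybe)
open import Data.Product using (_×_; _,_; proj₁; proj₂)
open import Data.Vec using (Vec; lookup; toList)
open import Data.Fin as Fin using (Fin; toℕ)
open import Data.List.Membership.Propositional using (_∈_)
open import Data.List.Relation.Binary.Permutation.Propositional using (_↭_)
open import Relation.Binary.PropositionalEquality using (_≡_)

-- Generic helpers (all indices are 1-based, as in the paper)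

-- (a,b] = {a+1,…,b};  [m] = (0,m]
interval : ℕ → ℕ → List ℕ
interval a b = applyUpTo (λ k → suc (a + k)) (b ∸ a)

atD : {A : Set} → A → List A → ℕ → A
atD d [] _ = d
atD d (x ∷ xs) zero = d
atD d (x ∷ xs) (suc zero) = x
atD d (x ∷ xs) (suc (suc k)) = atD d xs (suc k)

at : List ℕ → ℕ → ℕ
at = atD 0

memb : ℕ → List ℕ → Bool
memb k = any (_≡ᵇ k)

listEq : List ℕ → List ℕ → Bool
listEq [] [] = true
listEq [] (_ ∷ _) = false
listEq (_ ∷ _) [] = false
listEq (x ∷ xs) (y ∷ ys) = (x ≡ᵇ y) ∧ listEq xs ys

IsPartition : {n : ℕ} → Vec ℕ n → Set
IsPartition {n} lam = (i j : Fin n) → i Fin.≤ j → lookup lam j ≤ lookup lam i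

zeta : ℕ → List ℕ → ℕ → ℕ
zeta n lam j = length (filterᵇ (λ i → j ≤ᵇ at lam i) (interval 0 n))

boxes : ℕ → List ℕ → List (ℕ × ℕ)
boxes n lam = concatMap (λ j → map (λ i → (j , i)) (interval 0 (zeta n lam j)))
                        (interval 0 (at lam 1))

-- Fillings / tableaux.  A filling is a list of columns (left to right),
-- each column the list of its entries from top to bottom.

Filling : Set
Filling = List (List ℕ)

entry : Filling → ℕ → ℕ → ℕ
entry T j i = at (atD [] T j) i

words : ℕ → ℕ → List (List ℕ)
words n zero = [] ∷ []
words n (suc k) = concatMap (λ x → map (x ∷_) (words n k)) (interval 0 n)

fillings : ℕ → List ℕ → List Filling
fillings n [] = [] ∷ []
fillings n (l ∷ ls) = concatMap (λ c → map (c ∷_) (fillings n ls)) (words n l)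

shapeFillings : ℕ → List ℕ → List Filling
shapeFillings n lam = fillings n (map (zeta n lam) (interval 0 (at lam 1)))

isTableau : ℕ → List ℕ → Filling → Bool
isTableau n lam T =
  (length T ≡ᵇ at lam 1)
  ∧ all (λ j → length (atD [] T j) ≡ᵇ zeta n lam j) (interval 0 (at lam 1))
  ∧ all (λ b → let j = proj₁ b ; i = proj₂ b in
           (1 ≤ᵇ entry T j i) ∧ (entry T j i ≤ᵇ n)
         ∧ (not (suc i ≤ᵇ zeta n lam j) ∨ (entry T j i <ᵇ entry T j (suc i)))
         ∧ (not ((suc j ≤ᵇ at lam 1) ∧ (i ≤ᵇ zeta n lam (suc j)))
              ∨ (entry T j i ≤ᵇ entry T (suc j) i)))
        (boxes n lam)

tableaux : ℕ → List ℕ → List Filling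
tableaux n lam = filterᵇ (isTableau n lam) (shapeFillings n lam)

leqTab : ℕ → List ℕ → Filling → Filling → Bool
leqTab n lam A B = all (λ b → entry A (proj₁ b) (proj₂ b) ≤ᵇ entry B (proj₁ b) (proj₂ b))
                       (boxes n lam)

-- Content and generating polynomials.
-- A polynomial in x₁,…,xₙ with ℕ-coefficients is represented by its
-- coefficient function: exponent vector (θ₁,…,θₙ) ↦ coefficient.

content : ℕ → Filling → List ℕ
content n T = map (λ i → length (filterᵇ (_≡ᵇ i) (concat T))) (interval 0 n)

genPoly : ℕ → List Filling → List ℕ → ℕ
genPoly n S θ = length (filterᵇ (λ T → listEq (content n T) θ) S)

_≈Poly_ : (List ℕ → ℕ) → (List ℕ → ℕ) → Set
f ≈Poly g = ∀ θ → f θ ≡ g θ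

InU : {n : ℕ} → Vec ℕ n → Vec ℕ n → Set
InU {n} lam β = (i : Fin n) → (suc (toℕ i) ≤ lookup β i) × (lookup β i ≤ n)

flaggedSet : ℕ → List ℕ → List ℕ → List Filling
flaggedSet n lam β =
  filterᵇ (λ T → all (λ b → entry T (proj₁ b) (proj₂ b) ≤ᵇ at β (proj₂ b)) (boxes n lam))
          (tableaux n lam)

sPoly : {n : ℕ} → Vec ℕ n → Vec ℕ n → List ℕ → ℕ
sPoly {n} lam β = genPoly n (flaggedSet n (toList lam) (toList β))

Rset : ℕ → List ℕ → List ℕ
Rset n lam = filterᵇ (λ q → any (λ j → zeta n lam j ≡ᵇ q) (interval 0 (at lam 1)))
                     (interval 0 (n ∸ 1))

-- q₀ = 0, q₁ < ⋯ < q_r the elements of R_λ, q_{r+1} = n  (q h, 0 ≤ h ≤ r+1)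
qList : ℕ → List ℕ → List ℕ
qList n lam = 0 ∷ (Rset n lam ++ (n ∷ []))

q : ℕ → List ℕ → ℕ → ℕ
q n lam h = at (qList n lam) (suc h)

rOf : ℕ → List ℕ → ℕ
rOf n lam = length (Rset n lam)

carrels : ℕ → List ℕ → List (ℕ × ℕ)
carrels n lam = map (λ h → (q n lam (h ∸ 1) , q n lam h)) (interval 0 (suc (rOf n lam)))

InSnλ : {n : ℕ} → Vec ℕ n → Vec ℕ n → Set
InSnλ {n} lam π =
  (toList π ↭ interval 0 n)
  × (∀ a b → (a , b) ∈ carrels n (toList lam) →
       ∀ i k → a < i → i < k → k ≤ b → at (toList π) i < at (toList π) k)

Ycol : ℕ → List ℕ → List ℕ
Ycol n Q = filterᵇ (λ k → memb k Q) (interval 0 n)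

key : ℕ → List ℕ → List ℕ → Filling
key n lam π =
  replicate (at lam n) (Ycol n (interval 0 n))
  ++ concatMap (λ h → replicate (at lam (q n lam h) ∸ at lam (q n lam (suc h)))
                                (Ycol n (take (q n lam h) π)))
               (reverse (interval 0 (rOf n lam)))

-- Unmarked parts of columns are stored bottom-to-top (the head
-- is the lowest unmarked box).  One pass: read the lowest unmarked values
-- of the columns still having unmarked boxes, left to right, take the
-- EWIS (earliest weakly increasing subsequence), mark its boxes, and
-- return its last value.
ewisPass : Maybe ℕ → List (List ℕ) → Maybe ℕ × List (List ℕ)
ewisPass cur [] = cur , []
ewisPass cur ([] ∷ cs) =
  let r = ewisPass cur cs in proj₁ r , ([] ∷ proj₂ r)
ewisPass nothing ((v ∷ c) ∷ cs) =
  let r = ewisPass (just v) cs in proj₁ r , (c ∷ proj₂ r)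
ewisPass (just u) ((v ∷ c) ∷ cs) =
  if u ≤ᵇ v
  then (let r = ewisPass (just v) cs in proj₁ r , (c ∷ proj₂ r))
  else (let r = ewisPass (just u) cs in proj₁ r , ((v ∷ c) ∷ proj₂ r))

scanPasses : ℕ → List (List ℕ) → List ℕ
scanPasses zero cs = []
scanPasses (suc k) cs =
  let r = ewisPass nothing cs in fromMaybe 0 (proj₁ r) ∷ scanPasses k (proj₂ r)

-- column j of S(T): the outputs fill column j from the bottom upward
scanCol : ℕ → List ℕ → Filling → ℕ → List ℕ
scanCol n lam T j = reverse (scanPasses (zeta n lam j) (map reverse (drop (j ∸ 1) T)))

scan : ℕ → List ℕ → Filling → Filling
scan n lam T = map (scanCol n lam T) (interval 0 (at lam 1))

demazureSet : {n : ℕ} → Vec ℕ n → Vec ℕ n → List Filling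
demazureSet {n} lam π =
  filterᵇ (λ T → leqTab n (toList lam) (scan n (toList lam) T) (key n (toList lam) (toList π)))
          (tableaux n (toList lam))

dPoly : {n : ℕ} → Vec ℕ n → Vec ℕ n → List ℕ → ℕ
dPoly {n} lam π = genPoly n (demazureSet lam π)

-- Both parts compare contents through countUpTo k = #{entries ≤ k}.  Equal
-- polynomials have equal coefficients, so a tableau in one set has a partner
-- of the same content in the other; and raising entries lowers countUpTo.
-- (i)  The minimal tableau T₀(λ) (box (j, i) holds i) is flagged by every
--      β ∈ U_λ(n) and has content λ; every tableau of shape λ' lies above
--      T₀(λ').  Comparing in both directions, T₀(λ) and T₀(λ') have the same
--      content, so λ = λ'.
-- (ii) The key Y_λ(π) is the filling with columns Y({π_1, …, π_{ζ_j}}); it is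
--      a tableau fixed by scanning, so it lies in 𝒟_λ(π), and has content
--      θ_{π_i} = λ_i.  Every T ∈ 𝒟_λ'(π') satisfies T ≤ S(T) ≤ Y_λ'(π'), so
--      both keys have the same content θ.  The carrel condition sorts π by
--      decreasing θ (ties increasing), which forces π = π', then λ = λ'.

module Submission where

open import Defs
open import Data.Nat using (ℕ; zero; suc; _+_; _∸_; _≤_; _<_; _≤ᵇ_; _<ᵇ_; _≡ᵇ_; z≤n; s≤s; _⊓_; _≤?_; _<?_; _≟_)
open import Data.Nat.Properties
open import Data.Bool using (Bool; true; false; _∧_; _∨_; not; T; if_then_else_)
open import Data.Bool.Properties using (T-∧; T-≡; T?)
open import Data.Bool.ListAction using (all; any)
open import Data.Unit using (tt)
open import Data.Maybe using (just)
open import Data.Empty using (⊥; ⊥-elim)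
open import Data.Sum using (_⊎_; inj₁; inj₂)
open import Data.Product using (_×_; _,_; proj₁; proj₂; Σ; uncurry)
open import Data.List using (List; []; _∷_; _++_; [_]; map; concat; concatMap; replicate;
  applyUpTo; take; drop; reverse; length; filterᵇ)
open import Data.List.Properties
open import Data.List.Membership.Propositional using (_∈_; _∉_; find; lose)
open import Data.List.Membership.Propositional.Properties
open import Data.List.Relation.Unary.Any using (here; there)
import Data.List.Relation.Unary.Any as Any
import Data.List.Relation.Unary.Any.Properties as AnyP
open import Data.List.Relation.Unary.All using (All; []; _∷_)
import Data.List.Relation.Unary.All as All
import Data.List.Relation.Unary.All.Properties as AllP
open import Data.List.Relation.Unary.AllPairs using (AllPairs; []; _∷_)
import Data.List.Relation.Unary.AllPairs as AllPairs
import Data.List.Relation.Unary.AllPairs.Properties as AllPairsP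
open import Data.List.Relation.Binary.Subset.Propositional using (_⊆_)
open import Data.List.Relation.Binary.Pointwise using (Pointwise; []; _∷_)
import Data.List.Relation.Binary.Pointwise as PW
open import Data.List.Relation.Binary.Permutation.Propositional using (_↭_; ↭-sym; ↭-trans; ↭⇒↭ₛ)
open import Data.List.Relation.Binary.Permutation.Propositional.Properties using (∈-resp-↭; ↭-length; filter-↭; drop-∷)
import Data.List.Relation.Binary.Permutation.Setoid.Properties as PermS
open import Data.List.Relation.Unary.Unique.Propositional using (Unique)
open import Data.Vec using (Vec; lookup; toList)
open import Data.Fin as Fin using (Fin; toℕ)
import Data.Fin.Properties as FinP
import Data.Vec.Properties as VecP
open import Function using (_∘_; Equivalence)
open import Relation.Nullary using (¬_; Dec; yes; no)
open import Relation.Binary.Definitions using (tri<; tri≈; tri>)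
open import Relation.Binary.PropositionalEquality
  using (_≡_; _≢_; refl; sym; trans; cong; cong₂; subst; subst₂; setoid; ≢-sym; module ≡-Reasoning)

∧-intro : ∀ {a b} → T a → T b → T (a ∧ b)
∧-intro p q = Equivalence.from T-∧ (p , q)

∧-fst : ∀ {a b} → T (a ∧ b) → T a
∧-fst p = proj₁ (Equivalence.to T-∧ p)

∧-snd : ∀ {a b} → T (a ∧ b) → T b
∧-snd {a} p = proj₂ (Equivalence.to (T-∧ {a}) p)

⇒-intro : ∀ {a b} → (T a → T b) → T (not a ∨ b)
⇒-intro {false} f = tt
⇒-intro {true} f = f tt

⇒-elim : ∀ {a b} → T (not a ∨ b) → T a → T b
⇒-elim {true} p _ = p

≤ᵇ-true : ∀ {m n} → (m ≤ᵇ n) ≡ true → m ≤ n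
≤ᵇ-true {m} {n} e = ≤ᵇ⇒≤ m n (Equivalence.from T-≡ e)

≤ᵇ-false : ∀ {m n} → (m ≤ᵇ n) ≡ false → n < m
≤ᵇ-false {m} {n} e = ≰⇒> (λ m≤n → subst T e (≤⇒≤ᵇ m≤n))

false-if-¬T : ∀ {b} → ¬ T b → b ≡ false
false-if-¬T {false} _ = refl
false-if-¬T {true} ¬b = ⊥-elim (¬b tt)

≤ᵇ-eval : ∀ {m n} → m ≤ n → (m ≤ᵇ n) ≡ true
≤ᵇ-eval m≤n = Equivalence.to T-≡ (≤⇒≤ᵇ m≤n)

≤ᵇ-eval-> : ∀ {m n} → n < m → (m ≤ᵇ n) ≡ false
≤ᵇ-eval-> {m} {n} n<m = false-if-¬T (λ m≤ᵇn → <⇒≱ n<m (≤ᵇ⇒≤ m n m≤ᵇn))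

≡ᵇ-eval-≡ : ∀ m → (m ≡ᵇ m) ≡ true
≡ᵇ-eval-≡ m = Equivalence.to T-≡ (≡⇒≡ᵇ m m refl)

≡ᵇ-eval-≢ : ∀ {m n} → m ≢ n → (m ≡ᵇ n) ≡ false
≡ᵇ-eval-≢ {m} {n} m≢n = false-if-¬T (m≢n ∘ ≡ᵇ⇒≡ m n)

at-beyond : ∀ (xs : List ℕ) k → length xs < k → at xs k ≡ 0
at-beyond [] k _ = refl
at-beyond (x ∷ xs) zero _ = refl
at-beyond (x ∷ xs) (suc (suc k)) (s≤s p) = at-beyond xs (suc k) p

atD-∈ : ∀ {A : Set} (d : A) xs i → 1 ≤ i → i ≤ length xs → atD d xs i ∈ xs
atD-∈ d (x ∷ xs) (suc zero) _ _ = here refl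
atD-∈ d (x ∷ xs) (suc (suc i)) _ (s≤s p) = there (atD-∈ d xs (suc i) (s≤s z≤n) p)

list-ext : ∀ {A : Set} (d : A) (xs ys : List A) → length xs ≡ length ys
  → (∀ i → 1 ≤ i → i ≤ length xs → atD d xs i ≡ atD d ys i) → xs ≡ ys
list-ext d [] [] _ _ = refl
list-ext d (x ∷ xs) (y ∷ ys) e f = cong₂ _∷_ (f 1 (s≤s z≤n) (s≤s z≤n))
  (list-ext d xs ys (suc-injective e) (λ { (suc i) _ i≤ → f (suc (suc i)) (s≤s z≤n) (s≤s i≤) }))

atD-applyUpTo : ∀ {A : Set} (d : A) (f : ℕ → A) k i → i < k → atD d (applyUpTo f k) (suc i) ≡ f i
atD-applyUpTo d f (suc k) zero _ = refl
atD-applyUpTo d f (suc k) (suc i) (s≤s i<k) = atD-applyUpTo d (f ∘ suc) k i i<k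

atD-tabulate : ∀ {A : Set} (d : A) (c : ℕ → A) k j → 1 ≤ j → j ≤ k → atD d (map c (interval 0 k)) j ≡ c j
atD-tabulate d c k (suc j) _ j<k =
  trans (cong (λ t → atD d t (suc j)) (map-applyUpTo suc c k)) (atD-applyUpTo d (c ∘ suc) k j j<k)

tabulate-entries : ∀ {A : Set} (d : A) xs → map (atD d xs) (interval 0 (length xs)) ≡ xs
tabulate-entries d [] = refl
tabulate-entries d (x ∷ xs) = cong (x ∷_) (begin
  map (atD d (x ∷ xs)) (applyUpTo (suc ∘ suc) (length xs)) ≡⟨ map-applyUpTo (suc ∘ suc) (atD d (x ∷ xs)) (length xs) ⟩
  applyUpTo (atD d xs ∘ suc) (length xs)                    ≡⟨ sym (map-applyUpTo suc (atD d xs) (length xs)) ⟩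
  map (atD d xs) (interval 0 (length xs))                   ≡⟨ tabulate-entries d xs ⟩
  xs                                                        ∎)
  where open ≡-Reasoning

drop-at : ∀ {A : Set} (d : A) xs j → 1 ≤ j → j ≤ length xs → drop (j ∸ 1) xs ≡ atD d xs j ∷ drop j xs
drop-at d (x ∷ xs) (suc zero) _ _ = refl
drop-at d (x ∷ xs) (suc (suc j)) _ (s≤s j≤) = drop-at d xs (suc j) (s≤s z≤n) j≤

Pointwise-at : ∀ {xs ys} → Pointwise _≤_ xs ys → ∀ i → at xs i ≤ at ys i
Pointwise-at [] i = z≤n
Pointwise-at (p ∷ ps) zero = z≤n
Pointwise-at (p ∷ ps) (suc zero) = p
Pointwise-at (p ∷ ps) (suc (suc i)) = Pointwise-at ps (suc i)

AllPairs⇒at : ∀ {R : ℕ → ℕ → Set} xs → AllPairs R xs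
  → ∀ i k → 1 ≤ i → i < k → k ≤ length xs → R (at xs i) (at xs k)
AllPairs⇒at [] [] _ (suc k) _ _ ()
AllPairs⇒at (x ∷ xs) (r ∷ _) (suc zero) (suc (suc k)) _ _ (s≤s p) =
  All.lookup r (atD-∈ 0 xs (suc k) (s≤s z≤n) p)
AllPairs⇒at (x ∷ xs) _ (suc zero) (suc zero) _ (s≤s ()) _
AllPairs⇒at (x ∷ xs) (_ ∷ rs) (suc (suc i)) (suc (suc k)) _ (s≤s i<k) (s≤s p) =
  AllPairs⇒at xs rs (suc i) (suc k) (s≤s z≤n) i<k p

∈⇒at : ∀ {x} xs → x ∈ xs → Σ ℕ λ i → i < length xs × at xs (suc i) ≡ x
∈⇒at (y ∷ ys) (here refl) = 0 , s≤s z≤n , refl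
∈⇒at (y ∷ ys) (there x∈) with ∈⇒at ys x∈
... | i , i< , e = suc i , s≤s i< , e

at⇒AllPairs : ∀ {R : ℕ → ℕ → Set} xs
  → (∀ i k → 1 ≤ i → i < k → k ≤ length xs → R (at xs i) (at xs k)) → AllPairs R xs
at⇒AllPairs [] _ = []
at⇒AllPairs {R} (x ∷ xs) f = All.tabulate head ∷ at⇒AllPairs xs tail
  where
  head : ∀ {y} → y ∈ xs → R x y
  head y∈ with ∈⇒at xs y∈
  ... | i , i< , refl = f 1 (suc (suc i)) (s≤s z≤n) (s≤s (s≤s z≤n)) (s≤s i<)
  tail : ∀ i k → 1 ≤ i → i < k → k ≤ length xs → R (at xs i) (at xs k)
  tail (suc i) (suc k) _ i<k k≤ = f (suc (suc i)) (suc (suc k)) (s≤s z≤n) (s≤s i<k) (s≤s k≤)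

map-const : ∀ {A B : Set} (c : B) (xs : List A) → map (λ _ → c) xs ≡ replicate (length xs) c
map-const c [] = refl
map-const c (x ∷ xs) = cong (c ∷_) (map-const c xs)

head-min : ∀ {x xs y} → AllPairs _<_ (x ∷ xs) → y ∈ x ∷ xs → x ≤ y
head-min _ (here refl) = ≤-refl
head-min (x< ∷ _) (there y∈) = <⇒≤ (All.lookup x< y∈)

sublist-at : ∀ xs ys → AllPairs _<_ xs → AllPairs _<_ ys → ys ⊆ xs
  → ∀ i → 1 ≤ i → i ≤ length ys → at xs i ≤ at ys i
sublist-at xs [] _ _ _ (suc i) _ ()
sublist-at [] (y ∷ ys) _ _ ys⊆ _ _ _ with ys⊆ (here refl)
... | ()
sublist-at (x ∷ xs) (y ∷ ys) inc-xs _ ys⊆ (suc zero) _ _ = head-min inc-xs (ys⊆ (here refl))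
sublist-at (x ∷ xs) (y ∷ ys) inc-xs (y< ∷ inc-ys) ys⊆ (suc (suc i)) _ (s≤s i≤) =
  sublist-at xs ys (AllPairs.tail inc-xs) inc-ys tail⊆ (suc i) (s≤s z≤n) i≤
  where
  tail⊆ : ys ⊆ xs
  tail⊆ z∈ with ys⊆ (there z∈)
  ... | here refl = ⊥-elim (<-irrefl refl (<-≤-trans (All.lookup y< z∈) (head-min inc-xs (ys⊆ (here refl)))))
  ... | there z∈xs = z∈xs

memb⇒∈ : ∀ {k} xs → T (memb k xs) → k ∈ xs
memb⇒∈ xs p = Any.map (λ e → sym (≡ᵇ⇒≡ _ _ e)) (AnyP.any⁻ _ xs p)

∈⇒memb : ∀ {k xs} → k ∈ xs → T (memb k xs)
∈⇒memb {k} k∈ = AnyP.any⁺ _ (Any.map (λ { refl → ≡⇒≡ᵇ k k refl }) k∈)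

concat-reverse-∷ : ∀ {X : Set} (y : List X) ys → concat (reverse (y ∷ ys)) ≡ concat (reverse ys) ++ y
concat-reverse-∷ y ys = begin
  concat (reverse (y ∷ ys))          ≡⟨ cong concat (unfold-reverse y ys) ⟩
  concat (reverse ys ++ [ y ])       ≡⟨ sym (concat-++ (reverse ys) [ y ]) ⟩
  concat (reverse ys) ++ (y ++ [])   ≡⟨ cong (concat (reverse ys) ++_) (++-identityʳ y) ⟩
  concat (reverse ys) ++ y           ∎
  where open ≡-Reasoning

concat-reverse-filter : ∀ {A X : Set} (f : A → List X) (p : A → Bool) xs
  → (∀ {x} → x ∈ xs → ¬ T (p x) → f x ≡ [])
  → concat (reverse (map f (filterᵇ p xs))) ≡ concat (reverse (map f xs))
concat-reverse-filter f p [] _ = refl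
concat-reverse-filter f p (x ∷ xs) empty with T? (p x)
... | yes px = begin
  concat (reverse (map f (filterᵇ p (x ∷ xs))))  ≡⟨ cong (concat ∘ reverse ∘ map f) (filter-accept (T? ∘ p) px) ⟩
  concat (reverse (f x ∷ map f (filterᵇ p xs)))  ≡⟨ concat-reverse-∷ (f x) (map f (filterᵇ p xs)) ⟩
  concat (reverse (map f (filterᵇ p xs))) ++ f x ≡⟨ cong (_++ f x) (concat-reverse-filter f p xs (empty ∘ there)) ⟩
  concat (reverse (map f xs)) ++ f x             ≡⟨ sym (concat-reverse-∷ (f x) (map f xs)) ⟩
  concat (reverse (f x ∷ map f xs))              ∎
  where open ≡-Reasoning
... | no ¬px = begin
  concat (reverse (map f (filterᵇ p (x ∷ xs))))  ≡⟨ cong (concat ∘ reverse ∘ map f) (filter-reject (T? ∘ p) ¬px) ⟩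
  concat (reverse (map f (filterᵇ p xs)))        ≡⟨ concat-reverse-filter f p xs (empty ∘ there) ⟩
  concat (reverse (map f xs))                    ≡⟨ sym (++-identityʳ _) ⟩
  concat (reverse (map f xs)) ++ []              ≡⟨ cong (concat (reverse (map f xs)) ++_) (sym (empty (here refl) ¬px)) ⟩
  concat (reverse (map f xs)) ++ f x             ≡⟨ sym (concat-reverse-∷ (f x) (map f xs)) ⟩
  concat (reverse (f x ∷ map f xs))              ∎
  where open ≡-Reasoning

filter-cong-local : ∀ {A : Set} (p q : A → Bool) xs → (∀ {x} → x ∈ xs → (T (p x) → T (q x)) × (T (q x) → T (p x)))
  → filterᵇ p xs ≡ filterᵇ q xs
filter-cong-local p q [] _ = refl
filter-cong-local p q (x ∷ xs) agree with T? (p x)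
... | yes px = trans (filter-accept (T? ∘ p) px)
  (trans (cong (x ∷_) (filter-cong-local p q xs (agree ∘ there))) (sym (filter-accept (T? ∘ q) (proj₁ (agree (here refl)) px))))
... | no ¬px = trans (filter-reject (T? ∘ p) ¬px)
  (trans (filter-cong-local p q xs (agree ∘ there)) (sym (filter-reject (T? ∘ q) (¬px ∘ proj₂ (agree (here refl))))))

take-⊆ : ∀ {z' z} (xs : List ℕ) → z' ≤ z → take z' xs ⊆ take z xs
take-⊆ {suc z'} {suc z} (y ∷ ys) (s≤s z'≤z) (here refl) = here refl
take-⊆ {suc z'} {suc z} (y ∷ ys) (s≤s z'≤z) (there x∈) = there (take-⊆ ys z'≤z x∈)

segment : ℕ → ℕ → List ℕ
segment a d = applyUpTo (λ k → suc (a + k)) d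

∈-segment⁻ : ∀ a d {x} → x ∈ segment a d → a < x × x ≤ a + d
∈-segment⁻ a d x∈ with ∈-applyUpTo⁻ (λ k → suc (a + k)) x∈
... | k , k<d , refl = s≤s (m≤m+n a k) , +-monoʳ-< a k<d

∈-segment⁺ : ∀ a d {x} → a < x → x ≤ a + d → x ∈ segment a d
∈-segment⁺ a d {suc x} (s≤s a≤x) x<a+d =
  subst (_∈ segment a d) (cong suc (m+[n∸m]≡n a≤x))
    (∈-applyUpTo⁺ (λ k → suc (a + k)) (+-cancelˡ-< a _ _ (subst (_< a + d) (sym (m+[n∸m]≡n a≤x)) x<a+d)))

segment-sorted : ∀ a d → AllPairs _<_ (segment a d)
segment-sorted a d = AllPairsP.applyUpTo⁺₁ _ d (λ i<j _ → s≤s (+-monoʳ-< a i<j))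

length-segment : ∀ a d → length (segment a d) ≡ d
length-segment a d = length-applyUpTo _ d

applyUpTo-cong : ∀ {A : Set} {f g : ℕ → A} d → (∀ k → f k ≡ g k) → applyUpTo f d ≡ applyUpTo g d
applyUpTo-cong zero _ = refl
applyUpTo-cong (suc d) f≗g = cong₂ _∷_ (f≗g 0) (applyUpTo-cong d (f≗g ∘ suc))

segment-suc : ∀ a d → segment a (suc d) ≡ suc a ∷ segment (suc a) d
segment-suc a d = cong₂ _∷_ (cong suc (+-identityʳ a)) (applyUpTo-cong d (λ k → cong suc (+-suc a k)))

drop-segment : ∀ a d j → drop j (segment a d) ≡ segment (a + j) (d ∸ j)
drop-segment a d zero = cong (λ t → segment t d) (sym (+-identityʳ a))
drop-segment a zero (suc j) = refl
drop-segment a (suc d) (suc j) = begin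
  drop (suc j) (segment a (suc d))   ≡⟨ cong (drop (suc j)) (segment-suc a d) ⟩
  drop j (segment (suc a) d)         ≡⟨ drop-segment (suc a) d j ⟩
  segment (suc a + j) (d ∸ j)        ≡⟨ cong (λ t → segment t (d ∸ j)) (sym (+-suc a j)) ⟩
  segment (a + suc j) (d ∸ j)        ∎
  where open ≡-Reasoning

segment-snoc : ∀ a d → segment a (suc d) ≡ segment a d ++ [ suc (a + d) ]
segment-snoc a d = sym (applyUpTo-∷ʳ _ d)

segment-++ : ∀ a d₁ d₂ → segment a (d₁ + d₂) ≡ segment a d₁ ++ segment (a + d₁) d₂
segment-++ a zero d₂ = cong (λ t → segment t d₂) (sym (+-identityʳ a))
segment-++ a (suc d₁) d₂ = begin
  segment a (suc d₁ + d₂)                          ≡⟨ segment-suc a (d₁ + d₂) ⟩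
  suc a ∷ segment (suc a) (d₁ + d₂)                ≡⟨ cong (suc a ∷_) (segment-++ (suc a) d₁ d₂) ⟩
  suc a ∷ segment (suc a) d₁ ++ segment (suc a + d₁) d₂
    ≡⟨ cong₂ (λ s t → s ++ segment t d₂) (sym (segment-suc a d₁)) (sym (+-suc a d₁)) ⟩
  segment a (suc d₁) ++ segment (a + suc d₁) d₂    ∎
  where open ≡-Reasoning

∈-interval⁻ : ∀ a b {x} → x ∈ interval a b → a < x × x ≤ b
∈-interval⁻ a b {x} x∈ with ∈-segment⁻ a (b ∸ a) x∈ | a ≤? b
... | a<x , x≤ | yes a≤b = a<x , subst (x ≤_) (m+[n∸m]≡n a≤b) x≤
... | a<x , x≤ | no a≰b =
  ⊥-elim (<⇒≱ a<x (subst (x ≤_) (trans (cong (a +_) (m≤n⇒m∸n≡0 (≰⇒≥ a≰b))) (+-identityʳ a)) x≤))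

∈-interval⁺ : ∀ a b {x} → a < x → x ≤ b → x ∈ interval a b
∈-interval⁺ a b {x} a<x x≤b =
  ∈-segment⁺ a (b ∸ a) a<x (subst (x ≤_) (sym (m+[n∸m]≡n (≤-trans (<⇒≤ a<x) x≤b))) x≤b)

interval-++ : ∀ {a b c} → a ≤ b → b ≤ c → interval a c ≡ interval a b ++ interval b c
interval-++ {a} {b} {c} a≤b b≤c = begin
  segment a (c ∸ a)                           ≡⟨ cong (segment a) c∸a ⟩
  segment a ((b ∸ a) + (c ∸ b))               ≡⟨ segment-++ a (b ∸ a) (c ∸ b) ⟩
  segment a (b ∸ a) ++ segment (a + (b ∸ a)) (c ∸ b)
    ≡⟨ cong (λ t → segment a (b ∸ a) ++ segment t (c ∸ b)) (m+[n∸m]≡n a≤b) ⟩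
  segment a (b ∸ a) ++ segment b (c ∸ b)      ∎
  where
  open ≡-Reasoning
  c∸a : c ∸ a ≡ (b ∸ a) + (c ∸ b)
  c∸a = trans (cong (_∸ a) (sym (m+[n∸m]≡n b≤c))) (+-∸-comm (c ∸ b) a≤b)

steps : List ℕ → List (ℕ × ℕ)
steps [] = []
steps (x ∷ []) = []
steps (x ∷ y ∷ zs) = (x , y) ∷ steps (y ∷ zs)

steps-as-applyUpTo : ∀ {X : Set} (F : ℕ → ℕ → X) Q
  → applyUpTo (λ k → F (at Q (suc k)) (at Q (suc (suc k)))) (length Q ∸ 1) ≡ map (uncurry F) (steps Q)
steps-as-applyUpTo F [] = refl
steps-as-applyUpTo F (x ∷ []) = refl
steps-as-applyUpTo F (x ∷ y ∷ zs) = cong (F x y ∷_) (steps-as-applyUpTo F (y ∷ zs))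

steps-fst : ∀ xs e → map proj₁ (steps (xs ++ [ e ])) ≡ xs
steps-fst [] e = refl
steps-fst (x ∷ []) e = refl
steps-fst (x ∷ y ∷ ys) e = cong (x ∷_) (steps-fst (y ∷ ys) e)

steps-increasing : ∀ {Q a b} → AllPairs _<_ Q → (a , b) ∈ steps Q → a < b
steps-increasing {x ∷ y ∷ zs} ((x<y ∷ _) ∷ _) (here refl) = x<y
steps-increasing {x ∷ y ∷ zs} (_ ∷ sorted) (there ab∈) = steps-increasing sorted ab∈

steps-fst-∈ : ∀ {Q a b} → (a , b) ∈ steps Q → a ∈ Q
steps-fst-∈ {x ∷ y ∷ zs} (here refl) = here refl
steps-fst-∈ {x ∷ y ∷ zs} (there ab∈) = there (steps-fst-∈ ab∈)

steps-snd-∈ : ∀ {Q a b} → (a , b) ∈ steps Q → b ∈ Q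
steps-snd-∈ {x ∷ y ∷ zs} (here refl) = there (here refl)
steps-snd-∈ {x ∷ y ∷ zs} (there ab∈) = there (steps-snd-∈ ab∈)

steps-adjacent : ∀ {Q a b y} → AllPairs _<_ Q → (a , b) ∈ steps Q → y ∈ Q → a < y → b ≤ y
steps-adjacent {x ∷ y ∷ zs} _ (here refl) (here refl) x<x = ⊥-elim (<-irrefl refl x<x)
steps-adjacent {x ∷ y ∷ zs} _ (here refl) (there (here refl)) _ = ≤-refl
steps-adjacent {x ∷ y ∷ zs} (_ ∷ (y< ∷ _)) (here refl) (there (there w∈)) _ = <⇒≤ (All.lookup y< w∈)
steps-adjacent {x ∷ y ∷ zs} (x< ∷ _) (there ab∈) (here refl) a<x =
  ⊥-elim (<-asym a<x (All.lookup x< (steps-fst-∈ ab∈)))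
steps-adjacent {x ∷ y ∷ zs} (_ ∷ sorted) (there ab∈) (there w∈) a<w = steps-adjacent sorted ab∈ w∈ a<w

steps-cover : ∀ x₀ xs e {i k} → x₀ < i → k ≤ e → (∀ {y} → y ∈ xs → i ≤ y → k ≤ y)
  → Σ (ℕ × ℕ) λ ab → ab ∈ steps (x₀ ∷ xs ++ [ e ]) × proj₁ ab < i × k ≤ proj₂ ab
steps-cover x₀ [] e x₀<i k≤e _ = (x₀ , e) , here refl , x₀<i , k≤e
steps-cover x₀ (y ∷ ys) e {i} {k} x₀<i k≤e gap with k ≤? y
... | yes k≤y = (x₀ , y) , here refl , x₀<i , k≤y
... | no k≰y with i ≤? y
...   | yes i≤y = ⊥-elim (k≰y (gap (here refl) i≤y))
...   | no i≰y with steps-cover y ys e (≰⇒> i≰y) k≤e (gap ∘ there)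
...     | ab , ab∈ , a<i , k≤b = ab , there ab∈ , a<i , k≤b

descent : ∀ (f : ℕ → ℕ) a d → f (a + d) < f a → Σ ℕ λ t → a ≤ t × t < a + d × f (suc t) < f t
descent f a zero drop = ⊥-elim (<-irrefl (cong f (+-identityʳ a)) drop)
descent f a (suc d) drop with f (suc a) <? f a
... | yes step = a , ≤-refl , subst (a <_) (sym (+-suc a d)) (s≤s (m≤m+n a d)) , step
... | no no-step with descent f (suc a) d (≤-trans (subst (λ t → f t < f a) (+-suc a d) drop) (≮⇒≥ no-step))
...   | t , a<t , t< , step = t , ≤-trans (n≤1+n a) a<t , subst (t <_) (sym (+-suc a d)) t< , step

at-toList : ∀ {n} (v : Vec ℕ n) (f : Fin n) → at (toList v) (suc (toℕ f)) ≡ lookup v f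
at-toList (x Data.Vec.∷ v) Fin.zero = refl
at-toList (x Data.Vec.∷ v) (Fin.suc f) = at-toList v f

toList-injective : ∀ {n} (u v : Vec ℕ n) → toList u ≡ toList v → u ≡ v
toList-injective u v e = trans (sym (VecP.cast-is-id refl u)) (VecP.toList-injective refl u v e)

Vec-ext : ∀ {n} (u v : Vec ℕ n) → (∀ i → 1 ≤ i → i ≤ n → at (toList u) i ≡ at (toList v) i) → u ≡ v
Vec-ext {n} u v agree = toList-injective u v (list-ext 0 (toList u) (toList v)
  (trans (VecP.length-toList u) (sym (VecP.length-toList v)))
  (λ i 1≤i i≤ → agree i 1≤i (subst (i ≤_) (VecP.length-toList u) i≤)))

at-toList-fromℕ< : ∀ {n} (v : Vec ℕ n) {i} (i<n : i < n)
  → at (toList v) (suc i) ≡ lookup v (Fin.fromℕ< i<n)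
at-toList-fromℕ< v i<n =
  trans (cong (λ t → at (toList v) (suc t)) (sym (FinP.toℕ-fromℕ< i<n))) (at-toList v _)

-- Partitions, read as lists with  at L i = λ_i  (and λ_i = 0 beyond the last part).

Partition : List ℕ → Set
Partition L = ∀ i k → 1 ≤ i → i ≤ k → at L k ≤ at L i

IsPartition⇒Partition : ∀ {n} (v : Vec ℕ n) → IsPartition v → Partition (toList v)
IsPartition⇒Partition {n} v P (suc i) k _ i≤k with k ≤? n
... | no k≰n = subst (_≤ at (toList v) (suc i))
  (sym (at-beyond (toList v) k (subst (_< k) (sym (VecP.length-toList v)) (≰⇒> k≰n)))) z≤n
... | yes k≤n with k | i≤k
...   | suc k' | s≤s i≤k' = subst₂ _≤_ (sym (at-toList-fromℕ< v k≤n)) (sym (at-toList-fromℕ< v i<n))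
          (P _ _ (subst₂ _≤_ (sym (FinP.toℕ-fromℕ< i<n)) (sym (FinP.toℕ-fromℕ< k≤n)) i≤k'))
  where
  i<n = ≤-trans (s≤s i≤k') k≤n

-- For a predicate p closed downwards on positive integers, the number of
-- i ∈ [1..m] with p i is the largest such i (up to m):  i ≤ size m ⇔ p i.
module DownClosed (p : ℕ → Bool) (down : ∀ {i i'} → 1 ≤ i' → i' ≤ i → T (p i) → T (p i')) where

  size : ℕ → ℕ
  size m = length (filterᵇ p (interval 0 m))

  size≤ : ∀ m → size m ≤ m
  size≤ m = subst (size m ≤_) (length-segment 0 m) (length-filter (T? ∘ p) (interval 0 m))

  size-yes : ∀ m → T (p (suc m)) → size (suc m) ≡ suc m
  size-yes m pm = trans (cong length (filter-all (T? ∘ p) (All.tabulate all-p))) (length-segment 0 (suc m))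
    where
    all-p : ∀ {x} → x ∈ interval 0 (suc m) → T (p x)
    all-p x∈ = let 0<x , x≤ = ∈-segment⁻ 0 (suc m) x∈ in down 0<x x≤ pm

  size-no : ∀ m → ¬ T (p (suc m)) → size (suc m) ≡ size m
  size-no m ¬pm = begin
    length (filterᵇ p (interval 0 (suc m)))                   ≡⟨ cong (length ∘ filterᵇ p) (segment-snoc 0 m) ⟩
    length (filterᵇ p (interval 0 m ++ [ suc m ]))             ≡⟨ cong length (filter-++ (T? ∘ p) (interval 0 m) _) ⟩
    length (filterᵇ p (interval 0 m) ++ filterᵇ p [ suc m ])   ≡⟨ cong (λ t → length (filterᵇ p (interval 0 m) ++ t)) (filter-reject (T? ∘ p) {xs = []} ¬pm) ⟩
    length (filterᵇ p (interval 0 m) ++ [])                    ≡⟨ cong length (++-identityʳ (filterᵇ p (interval 0 m))) ⟩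
    size m                                                     ∎
    where open ≡-Reasoning

  ≤size : ∀ m i → 1 ≤ i → i ≤ m → T (p i) → i ≤ size m
  ≤size zero (suc i) _ () _
  ≤size (suc m) i 1≤i i≤ pi with T? (p (suc m))
  ... | yes pm = subst (i ≤_) (sym (size-yes m pm)) i≤
  ... | no ¬pm with i ≟ suc m
  ...   | yes refl = ⊥-elim (¬pm pi)
  ...   | no i≢ = subst (i ≤_) (sym (size-no m ¬pm)) (≤size m i 1≤i (≤-pred (≤∧≢⇒< i≤ i≢)) pi)

  size≥ : ∀ m i → 1 ≤ i → i ≤ m → i ≤ size m → T (p i)
  size≥ zero (suc i) _ () _
  size≥ (suc m) i 1≤i i≤ i≤size with T? (p (suc m))
  ... | yes pm = down 1≤i i≤ pm
  ... | no ¬pm with i ≟ suc m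
  ...   | yes refl = ⊥-elim (<-irrefl refl (≤-trans (subst (suc m ≤_) (size-no m ¬pm) i≤size) (size≤ m)))
  ...   | no i≢ = size≥ m i 1≤i (≤-pred (≤∧≢⇒< i≤ i≢)) (subst (i ≤_) (size-no m ¬pm) i≤size)

module ColumnLengths (n : ℕ) (L : List ℕ) (P : Partition L) where

  ζ : ℕ → ℕ
  ζ = zeta n L

  private
    module D (j : ℕ) = DownClosed (λ i → j ≤ᵇ at L i)
      (λ 1≤i' i'≤i j≤ → ≤⇒≤ᵇ (≤-trans (≤ᵇ⇒≤ j _ j≤) (P _ _ 1≤i' i'≤i)))

  ζ≤n : ∀ j → ζ j ≤ n
  ζ≤n j = D.size≤ j n

  in-shape⇒ : ∀ {i j} → 1 ≤ i → i ≤ n → j ≤ at L i → i ≤ ζ j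
  in-shape⇒ {i} {j} 1≤i i≤n j≤ = D.≤size j n i 1≤i i≤n (≤⇒≤ᵇ j≤)

  in-shape⇐ : ∀ {i j} → 1 ≤ i → i ≤ n → i ≤ ζ j → j ≤ at L i
  in-shape⇐ {i} {j} 1≤i i≤n i≤ζ = ≤ᵇ⇒≤ j _ (D.size≥ j n i 1≤i i≤n i≤ζ)

  ζ-antitone : ∀ {j j'} → j ≤ j' → ζ j' ≤ ζ j
  ζ-antitone {j} {j'} j≤j' with ζ j' in eq
  ... | zero = z≤n
  ... | suc i = in-shape⇒ (s≤s z≤n) i≤n (≤-trans j≤j' (in-shape⇐ (s≤s z≤n) i≤n (≤-reflexive (sym eq))))
    where
    i≤n = subst (_≤ n) eq (ζ≤n j')

  ζ-exact : ∀ {q j} → 1 ≤ q → q ≤ n → j ≤ at L q → at L (suc q) < j → ζ j ≡ q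
  ζ-exact {q} {j} 1≤q q≤n j≤λq λq+1<j = ≤-antisym ζ≤q (in-shape⇒ 1≤q q≤n j≤λq)
    where
    ζ≤q : ζ j ≤ q
    ζ≤q with q <? n
    ... | no q≮n = subst (ζ j ≤_) (≤-antisym (≮⇒≥ q≮n) q≤n) (ζ≤n j)
    ... | yes q<n with suc q ≤? ζ j
    ...   | yes q<ζ = ⊥-elim (<⇒≱ λq+1<j (in-shape⇐ (s≤s z≤n) q<n q<ζ))
    ...   | no q≮ζ = ≤-pred (≰⇒> q≮ζ)

  lengthBlock : ℕ → List ℕ
  lengthBlock q = replicate (at L q ∸ at L (suc q)) q

  lengths-from : ∀ q → q ≤ n
    → map ζ (interval (at L (suc q)) (at L 1)) ≡ concat (reverse (map lengthBlock (interval 0 q)))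
  lengths-from zero _ = cong (map ζ ∘ segment (at L 1)) (n∸n≡0 (at L 1))
  lengths-from (suc q) q<n = begin
    map ζ (interval (at L (suc (suc q))) (at L 1))
      ≡⟨ cong (map ζ) (interval-++ (P (suc q) (suc (suc q)) (s≤s z≤n) (n≤1+n _)) (P 1 (suc q) ≤-refl (s≤s z≤n))) ⟩
    map ζ (interval (at L (suc (suc q))) (at L (suc q)) ++ interval (at L (suc q)) (at L 1))
      ≡⟨ map-++ ζ (interval (at L (suc (suc q))) (at L (suc q))) _ ⟩
    map ζ (interval (at L (suc (suc q))) (at L (suc q))) ++ map ζ (interval (at L (suc q)) (at L 1))
      ≡⟨ cong₂ _++_ block (lengths-from q (≤-trans (n≤1+n q) q<n)) ⟩
    lengthBlock (suc q) ++ concat (reverse (map lengthBlock (interval 0 q)))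
      ≡⟨⟩
    concat (lengthBlock (suc q) ∷ reverse (map lengthBlock (interval 0 q)))
      ≡⟨ cong concat (sym (reverse-++ (map lengthBlock (interval 0 q)) [ lengthBlock (suc q) ])) ⟩
    concat (reverse (map lengthBlock (interval 0 q) ++ [ lengthBlock (suc q) ]))
      ≡⟨ cong (concat ∘ reverse) (sym (trans (cong (map lengthBlock) (segment-snoc 0 q)) (map-++ lengthBlock (interval 0 q) _))) ⟩
    concat (reverse (map lengthBlock (interval 0 (suc q))))   ∎
    where
    open ≡-Reasoning
    a = at L (suc (suc q))
    b = at L (suc q)
    block : map ζ (interval a b) ≡ lengthBlock (suc q)
    block = begin
      map ζ (interval a b)                     ≡⟨ map-cong-local (All.tabulate (λ j∈ → let a<j , j≤b = ∈-interval⁻ a b j∈ in ζ-exact (s≤s z≤n) q<n j≤b a<j)) ⟩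
      map (λ _ → suc q) (interval a b)         ≡⟨ map-const (suc q) (interval a b) ⟩
      replicate (length (interval a b)) (suc q) ≡⟨ cong (λ t → replicate t (suc q)) (length-segment a (b ∸ a)) ⟩
      lengthBlock (suc q)                      ∎

  columnLengths : at L (suc n) ≡ 0 → map ζ (interval 0 (at L 1)) ≡ concat (reverse (map lengthBlock (interval 0 n)))
  columnLengths λn+1≡0 = subst (λ t → map ζ (interval t (at L 1)) ≡ concat (reverse (map lengthBlock (interval 0 n)))) λn+1≡0 (lengths-from n ≤-refl)

module PartitionVec {n : ℕ} (lam : Vec ℕ n) (P : IsPartition lam) where

  L : List ℕ
  L = toList lam

  partition : Partition L
  partition = IsPartition⇒Partition lam P

  length-L : length L ≡ n
  length-L = VecP.length-toList lam

  beyond : at L (suc n) ≡ 0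
  beyond = at-beyond L (suc n) (s≤s (≤-reflexive length-L))

module Breakpoints (m : ℕ) (L : List ℕ) (P : Partition L) where

  n : ℕ
  n = suc m

  open ColumnLengths n L P public

  isBreak : ℕ → Bool
  isBreak q = any (λ j → ζ j ≡ᵇ q) (interval 0 (at L 1))

  break⇐ : ∀ {q} → 1 ≤ q → q < n → at L (suc q) < at L q → T (isBreak q)
  break⇐ {q} 1≤q q<n drop = AnyP.any⁺ _ (Any.map (λ { refl → ≡⇒≡ᵇ _ q ζ≡q }) j∈)
    where
    j∈ : suc (at L (suc q)) ∈ interval 0 (at L 1)
    j∈ = ∈-interval⁺ 0 (at L 1) (s≤s z≤n) (≤-trans drop (P 1 q ≤-refl 1≤q))
    ζ≡q : ζ (suc (at L (suc q))) ≡ q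
    ζ≡q = ζ-exact 1≤q (<⇒≤ q<n) drop ≤-refl

  break⇒ : ∀ {q} → 1 ≤ q → q < n → T (isBreak q) → at L (suc q) < at L q
  break⇒ {q} 1≤q q<n brk with at L (suc q) <? at L q | Any.satisfied (AnyP.any⁻ _ (interval 0 (at L 1)) brk)
  ... | yes drop | _ = drop
  ... | no no-drop | j , ζj≡ᵇq = ⊥-elim (<-irrefl (sym ζj≡q) (in-shape⇒ (s≤s z≤n) q<n j≤λq+1))
    where
    ζj≡q = ≡ᵇ⇒≡ (ζ j) q ζj≡ᵇq
    j≤λq+1 : j ≤ at L (suc q)
    j≤λq+1 = ≤-trans (in-shape⇐ 1≤q (<⇒≤ q<n) (≤-reflexive (sym ζj≡q))) (≮⇒≥ no-drop)

  ∈-Rset⁻ : ∀ {q} → q ∈ Rset n L → 1 ≤ q × q < n × at L (suc q) < at L q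
  ∈-Rset⁻ q∈ with ∈-filter⁻ (T? ∘ isBreak) q∈
  ... | q∈segment , brk with ∈-segment⁻ 0 m q∈segment
  ...   | 1≤q , q≤m = 1≤q , s≤s q≤m , break⇒ 1≤q (s≤s q≤m) brk

  ∈-Rset⁺ : ∀ {q} → 1 ≤ q → q < n → at L (suc q) < at L q → q ∈ Rset n L
  ∈-Rset⁺ 1≤q (s≤s q≤m) drop = ∈-filter⁺ (T? ∘ isBreak) (∈-segment⁺ 0 m 1≤q q≤m) (break⇐ 1≤q (s≤s q≤m) drop)

  no-break : ∀ {q} → 1 ≤ q → q ≤ m → ¬ T (isBreak q) → at L q ≡ at L (suc q)
  no-break {q} 1≤q q≤m ¬brk with at L (suc q) <? at L q
  ... | yes drop = ⊥-elim (¬brk (break⇐ 1≤q (s≤s q≤m) drop))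
  ... | no no-drop = ≤-antisym (≮⇒≥ no-drop) (P q (suc q) 1≤q (n≤1+n q))

  Q : List ℕ
  Q = Rset n L ++ [ n ]

  Q-sorted : AllPairs _<_ Q
  Q-sorted = AllPairsP.++⁺ (AllPairsP.filter⁺ (T? ∘ isBreak) (segment-sorted 0 m)) ([] ∷ [])
    (All.tabulate (λ q∈ → proj₁ (proj₂ (∈-Rset⁻ q∈)) ∷ []))

  Q-bounded : ∀ {b} → b ∈ Q → b ≤ n
  Q-bounded b∈ with ∈-++⁻ (Rset n L) b∈
  ... | inj₁ b∈R = <⇒≤ (proj₁ (proj₂ (∈-Rset⁻ b∈R)))
  ... | inj₂ (here refl) = ≤-refl

  constant-between : ∀ {a b} → (a , b) ∈ steps Q → at L (suc a) ≡ at L b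
  constant-between {a} {b} ab∈ = ≤-antisym no-drop-inside (P (suc a) b (s≤s z≤n) a<b)
    where
    a<b = steps-increasing Q-sorted ab∈
    no-drop-inside : at L (suc a) ≤ at L b
    no-drop-inside with at L b <? at L (suc a)
    ... | no no-drop = ≮⇒≥ no-drop
    ... | yes drop with descent (at L) (suc a) (b ∸ suc a) (subst (λ t → at L t < at L (suc a)) (sym (m+[n∸m]≡n a<b)) drop)
    ...   | t , a<t , t<a+d , step = ⊥-elim (<⇒≱ t<b (steps-adjacent Q-sorted ab∈ t∈Q a<t))
      where
      t<b = subst (t <_) (m+[n∸m]≡n a<b) t<a+d
      -- a drop of λ inside (a, b) would be a breakpoint between a and b
      t∈Q : t ∈ Q
      t∈Q = ∈-++⁺ˡ (∈-Rset⁺ (≤-trans (s≤s z≤n) a<t) (<-≤-trans t<b (Q-bounded (steps-snd-∈ ab∈))) step)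

  carrels-steps : carrels n L ≡ steps (0 ∷ Q)
  carrels-steps = begin
    carrels n L
      ≡⟨ map-applyUpTo suc _ (suc (rOf n L)) ⟩
    applyUpTo (λ k → at (0 ∷ Q) (suc k) , at (0 ∷ Q) (suc (suc k))) (suc (rOf n L))
      ≡⟨ cong (applyUpTo _) (sym (trans (length-++ (Rset n L)) (+-comm (rOf n L) 1))) ⟩
    applyUpTo (λ k → at (0 ∷ Q) (suc k) , at (0 ∷ Q) (suc (suc k))) (length (0 ∷ Q) ∸ 1)
      ≡⟨ steps-as-applyUpTo _,_ (0 ∷ Q) ⟩
    map (uncurry _,_) (steps (0 ∷ Q))
      ≡⟨ map-id (steps (0 ∷ Q)) ⟩
    steps (0 ∷ Q)  ∎
    where open ≡-Reasoning

  carrel-of : ∀ {i k} → 1 ≤ i → i < k → k ≤ n → at L i ≡ at L k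
    → Σ (ℕ × ℕ) λ ab → ab ∈ carrels n L × proj₁ ab < i × k ≤ proj₂ ab
  carrel-of {i} {k} 1≤i i<k k≤n λi≡λk with steps-cover 0 (Rset n L) n 1≤i k≤n no-break-in
    where
    no-break-in : ∀ {y} → y ∈ Rset n L → i ≤ y → k ≤ y
    no-break-in {y} y∈ i≤y with k ≤? y
    ... | yes k≤y = k≤y
    ... | no k≰y with ∈-Rset⁻ y∈
    ...   | 1≤y , _ , drop = ⊥-elim (<-irrefl (sym λi≡λk) (begin-strict
            at L k        ≤⟨ P (suc y) k (s≤s z≤n) (≰⇒> k≰y) ⟩
            at L (suc y)  <⟨ drop ⟩
            at L y        ≤⟨ P i y 1≤i i≤y ⟩
            at L i        ∎))
      where open ≤-Reasoning
  ... | ab , ab∈ , a<i , k≤b = ab , subst (ab ∈_) (sym carrels-steps) ab∈ , a<i , k≤b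

module KeyColumns (m : ℕ) (L : List ℕ) (P : Partition L) (π : List ℕ) where

  open Breakpoints m L P

  keyColumn : ℕ → List ℕ
  keyColumn z = Ycol n (take z π)

  keyBlock : ℕ → List (List ℕ)
  keyBlock q = replicate (at L q ∸ at L (suc q)) (keyColumn q)

  key-blocks : key n L π ≡ replicate (at L n) (Ycol n (interval 0 n)) ++ concat (reverse (map keyBlock (Rset n L)))
  key-blocks = cong (replicate (at L n) (Ycol n (interval 0 n)) ++_) (begin
    concatMap blockAt (reverse (interval 0 r))  ≡⟨ cong concat (reverse-map blockAt (interval 0 r)) ⟩
    concat (reverse (map blockAt (interval 0 r))) ≡⟨ cong (concat ∘ reverse) per-breakpoint ⟩
    concat (reverse (map keyBlock (Rset n L)))    ∎)
    where
    open ≡-Reasoning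
    r = rOf n L
    blockAt : ℕ → List (List ℕ)
    blockAt h = replicate (at L (q n L h) ∸ at L (q n L (suc h))) (keyColumn (q n L h))
    stepBlock : ℕ → ℕ → List (List ℕ)
    stepBlock a b = replicate (at L a ∸ at L b) (keyColumn a)
    per-breakpoint : map blockAt (interval 0 r) ≡ map keyBlock (Rset n L)
    per-breakpoint = begin
      map blockAt (interval 0 r)
        ≡⟨ map-applyUpTo suc blockAt r ⟩
      applyUpTo (λ k → stepBlock (at Q (suc k)) (at Q (suc (suc k)))) r
        ≡⟨ cong (applyUpTo _) (sym (trans (cong (_∸ 1) (length-++ (Rset n L))) (m+n∸n≡m r 1))) ⟩
      applyUpTo (λ k → stepBlock (at Q (suc k)) (at Q (suc (suc k)))) (length Q ∸ 1)
        ≡⟨ steps-as-applyUpTo stepBlock Q ⟩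
      map (uncurry stepBlock) (steps Q)
        ≡⟨ map-cong-local (All.tabulate (λ { {a , b} ab∈ →
             cong (λ t → replicate (at L a ∸ t) (keyColumn a)) (sym (constant-between ab∈)) })) ⟩
      map (keyBlock ∘ proj₁) (steps Q)
        ≡⟨ map-∘ (steps Q) ⟩
      map keyBlock (map proj₁ (steps Q))
        ≡⟨ cong (map keyBlock) (steps-fst (Rset n L) n) ⟩
      map keyBlock (Rset n L)  ∎

  key-columns : at L (suc n) ≡ 0 → π ↭ interval 0 n → key n L π ≡ map (keyColumn ∘ ζ) (interval 0 (at L 1))
  key-columns λn+1≡0 perm = sym (begin
    map (keyColumn ∘ ζ) (interval 0 (at L 1))
      ≡⟨ map-∘ (interval 0 (at L 1)) ⟩
    map keyColumn (map ζ (interval 0 (at L 1)))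
      ≡⟨ cong (map keyColumn) (columnLengths λn+1≡0) ⟩
    map keyColumn (concat (reverse (map lengthBlock (interval 0 n))))
      ≡⟨ sym (concat-map (reverse (map lengthBlock (interval 0 n)))) ⟩
    concat (map (map keyColumn) (reverse (map lengthBlock (interval 0 n))))
      ≡⟨ cong concat (reverse-map (map keyColumn) (map lengthBlock (interval 0 n))) ⟩
    concat (reverse (map (map keyColumn) (map lengthBlock (interval 0 n))))
      ≡⟨ cong (concat ∘ reverse) (trans (sym (map-∘ (interval 0 n))) (map-cong (λ q → map-replicate keyColumn _ q) (interval 0 n))) ⟩
    concat (reverse (map keyBlock (interval 0 n)))
      ≡⟨ cong (concat ∘ reverse) (trans (cong (map keyBlock) (segment-snoc 0 m)) (map-++ keyBlock (interval 0 m) [ n ])) ⟩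
    concat (reverse (map keyBlock (interval 0 m) ++ [ keyBlock n ]))
      ≡⟨ cong concat (reverse-++ (map keyBlock (interval 0 m)) [ keyBlock n ]) ⟩
    keyBlock n ++ concat (reverse (map keyBlock (interval 0 m)))
      ≡⟨ cong₂ _++_ full-block (sym (concat-reverse-filter keyBlock isBreak (interval 0 m) empty-block)) ⟩
    replicate (at L n) (Ycol n (interval 0 n)) ++ concat (reverse (map keyBlock (Rset n L)))
      ≡⟨ sym key-blocks ⟩
    key n L π  ∎)
    where
    open ≡-Reasoning
    full-block : keyBlock n ≡ replicate (at L n) (Ycol n (interval 0 n))
    full-block = cong₂ replicate (cong (at L n ∸_) λn+1≡0)
      (trans (cong (Ycol n) (take-all n π (≤-reflexive (trans (↭-length perm) (length-segment 0 n)))))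
             (filter-≐ (T? ∘ λ k → memb k π) (T? ∘ λ k → memb k (interval 0 n))
                (∈⇒memb ∘ ∈-resp-↭ perm ∘ memb⇒∈ π , ∈⇒memb ∘ ∈-resp-↭ (↭-sym perm) ∘ memb⇒∈ (interval 0 n))
                (interval 0 n)))
    empty-block : ∀ {q} → q ∈ interval 0 m → ¬ T (isBreak q) → keyBlock q ≡ []
    empty-block {q} q∈ ¬brk = let 1≤q , q≤m = ∈-segment⁻ 0 m q∈ in
      cong (λ t → replicate t (keyColumn q)) (trans (cong (_∸ at L (suc q)) (no-break 1≤q q≤m ¬brk)) (n∸n≡0 (at L (suc q))))

-- Scanning.  Columns are stored bottom-up, so a column of a tableau is a
-- strictly decreasing list.

Decreasing : List ℕ → Set
Decreasing = AllPairs (λ a b → b < a)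

-- One EWIS pass marks the lowest unmarked box of a column when it holds the
-- current value v (the only way it can be ≥ v when all values are ≤ v).
markValue : ℕ → List ℕ → List ℕ
markValue v [] = []
markValue v (w ∷ c) = if v ≤ᵇ w then c else w ∷ c

pass-constant : ∀ v ds → All (All (_≤ v)) ds → ewisPass (just v) ds ≡ (just v , map (markValue v) ds)
pass-constant v [] _ = refl
pass-constant v ([] ∷ cs) (_ ∷ bounded) rewrite pass-constant v cs bounded = refl
pass-constant v ((w ∷ c) ∷ cs) ((w≤v ∷ _) ∷ bounded) with v ≤ᵇ w in v≤ᵇw
... | true rewrite ≤-antisym w≤v (≤ᵇ-true v≤ᵇw) | pass-constant v cs bounded = refl
... | false rewrite pass-constant v cs bounded = refl

reverse-decreasing : ∀ {xs} → AllPairs _<_ xs → Decreasing (reverse xs)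
reverse-decreasing {[]} [] = []
reverse-decreasing {x ∷ xs} (x< ∷ inc) = subst Decreasing (sym (unfold-reverse x xs))
  (AllPairsP.++⁺ (reverse-decreasing inc) ([] ∷ [])
    (All.tabulate (λ y∈ → All.lookup x< (AnyP.reverse⁻ y∈) ∷ [])))

head-max : ∀ {v d x} → Decreasing (v ∷ d) → x ∈ v ∷ d → x ≤ v
head-max _ (here refl) = ≤-refl
head-max (v> ∷ _) (there x∈) = <⇒≤ (All.lookup v> x∈)

mark-∈⁻ : ∀ {v b x} → Decreasing b → All (_≤ v) b → x ∈ markValue v b → x ∈ b × x < v
mark-∈⁻ {v} {w ∷ c} (w> ∷ _) (w≤v ∷ _) x∈ with v ≤ᵇ w in v≤ᵇw
... | true = there x∈ , ≤-trans (All.lookup w> x∈) w≤v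
... | false with x∈
...   | here refl = here refl , ≤ᵇ-false v≤ᵇw
...   | there x∈c = there x∈c , <-trans (All.lookup w> x∈c) (≤ᵇ-false v≤ᵇw)

mark-∈⁺ : ∀ {v b x} → All (_≤ v) b → x ∈ b → x < v → x ∈ markValue v b
mark-∈⁺ {v} {w ∷ c} (w≤v ∷ _) x∈ x<v with v ≤ᵇ w in v≤ᵇw
... | false = x∈
... | true with x∈
...   | here refl = ⊥-elim (<⇒≱ x<v (≤ᵇ-true v≤ᵇw))
...   | there x∈c = x∈c

mark-decreasing : ∀ {v b} → Decreasing b → Decreasing (markValue v b)
mark-decreasing {v} {[]} dec = dec
mark-decreasing {v} {w ∷ c} (w> ∷ dec) with v ≤ᵇ w
... | true = dec
... | false = w> ∷ dec

record Nested (d : List ℕ) (ds : List (List ℕ)) : Set where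
  field
    decreasing : Decreasing d
    decreasing-right : All Decreasing ds
    inside : All (_⊆ d) ds
    chain : AllPairs (λ a b → b ⊆ a) ds

bounded-by-head : ∀ {v d b} → Decreasing (v ∷ d) → b ⊆ v ∷ d → All (_≤ v) b
bounded-by-head dec b⊆ = All.tabulate (λ x∈ → head-max dec (b⊆ x∈))

nested-bounded : ∀ {v d ds} → Nested (v ∷ d) ds → All (All (_≤ v)) ds
nested-bounded N = All.map (bounded-by-head (Nested.decreasing N)) (Nested.inside N)

nested-mark : ∀ {v d ds} → Nested (v ∷ d) ds → Nested d (map (markValue v) ds)
nested-mark {v} {d} {ds} N = record
  { decreasing = AllPairs.tail decreasing
  ; decreasing-right = AllP.map⁺ (All.map mark-decreasing decreasing-right)
  ; inside = AllP.map⁺ (All.zipWith marked-inside (decreasing-right , inside))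
  ; chain = AllPairsP.map⁺ (chain-marked ds decreasing-right inside chain)
  }
  where
  open Nested N
  bounded : ∀ {b} → b ⊆ v ∷ d → All (_≤ v) b
  bounded = bounded-by-head decreasing
  marked-inside : ∀ {b} → Decreasing b × b ⊆ v ∷ d → markValue v b ⊆ d
  marked-inside (dec , b⊆) x∈ with mark-∈⁻ dec (bounded b⊆) x∈
  ... | x∈b , x<v with b⊆ x∈b
  ...   | here refl = ⊥-elim (<-irrefl refl x<v)
  ...   | there x∈d = x∈d
  marked-⊆ : ∀ {b c} → Decreasing c → b ⊆ v ∷ d → c ⊆ v ∷ d → c ⊆ b → markValue v c ⊆ markValue v b
  marked-⊆ dec b⊆ c⊆ c⊆b x∈ = let x∈c , x<v = mark-∈⁻ dec (bounded c⊆) x∈ in mark-∈⁺ (bounded b⊆) (c⊆b x∈c) x<v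
  chain-marked : ∀ es → All Decreasing es → All (_⊆ v ∷ d) es → AllPairs (λ a b → b ⊆ a) es
    → AllPairs (λ a b → markValue v b ⊆ markValue v a) es
  chain-marked [] _ _ _ = []
  chain-marked (e ∷ es) (_ ∷ decs) (e⊆ ∷ es⊆) (e⊇ ∷ rest) =
    All.zipWith (λ { (dec , c⊆ , c⊆e) x∈ → marked-⊆ dec e⊆ c⊆ c⊆e x∈ }) (decs , All.zip (es⊆ , e⊇))
    ∷ chain-marked es decs es⊆ rest

scan-nested : ∀ d ds → Nested d ds → scanPasses (length d) (d ∷ ds) ≡ d
scan-nested [] ds _ = refl
scan-nested (v ∷ d) ds N rewrite pass-constant v ds (nested-bounded N) =
  cong (v ∷_) (scan-nested d (map (markValue v) ds) (nested-mark N))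

pass-≥ : ∀ u cs → Σ ℕ λ w → proj₁ (ewisPass (just u) cs) ≡ just w × u ≤ w
pass-≥ u [] = u , refl , ≤-refl
pass-≥ u ([] ∷ cs) = pass-≥ u cs
pass-≥ u ((w ∷ c) ∷ cs) with u ≤ᵇ w in u≤ᵇw
... | true = let w' , e , w≤w' = pass-≥ w cs in w' , e , ≤-trans (≤ᵇ-true u≤ᵇw) w≤w'
... | false = pass-≥ u cs

scan-≥ : ∀ k d ds → k ≤ length d → Pointwise _≤_ (take k d) (scanPasses k (d ∷ ds))
scan-≥ zero d ds _ = []
scan-≥ (suc k) (v ∷ d) ds (s≤s k≤) with pass-≥ v ds
... | w , e , v≤w rewrite e = v≤w ∷ scan-≥ k d _ k≤

entryAt : Filling → ℕ × ℕ → ℕ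
entryAt F (j , i) = entry F j i

words⁺ : ∀ n k w → length w ≡ k → All (_∈ interval 0 n) w → w ∈ words n k
words⁺ n zero [] _ _ = here refl
words⁺ n (suc k) (x ∷ w) len (x∈ ∷ w∈) =
  ∈-concatMap⁺ (λ y → map (y ∷_) (words n k)) (lose x∈ (∈-map⁺ (x ∷_) (words⁺ n k w (suc-injective len) w∈)))

fillings⁺ : ∀ n ls cs → Pointwise (λ c l → length c ≡ l × All (_∈ interval 0 n) c) cs ls → cs ∈ fillings n ls
fillings⁺ n [] [] [] = here refl
fillings⁺ n (l ∷ ls) (c ∷ cs) ((len , c∈) ∷ rest) =
  ∈-concatMap⁺ (λ d → map (d ∷_) (fillings n ls)) (lose (words⁺ n l c len c∈) (∈-map⁺ (c ∷_) (fillings⁺ n ls cs rest)))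

module Shape (n : ℕ) (L : List ℕ) where

  λ₁ : ℕ
  λ₁ = at L 1

  cols : List ℕ
  cols = interval 0 λ₁

  ζ : ℕ → ℕ
  ζ = zeta n L

  boxes⁻ : ∀ {j i} → (j , i) ∈ boxes n L → j ∈ cols × i ∈ interval 0 (ζ j)
  boxes⁻ b∈ with find (∈-concatMap⁻ (λ j → map (j ,_) (interval 0 (ζ j))) b∈)
  ... | j , j∈ , b∈col with ∈-map⁻ (j ,_) b∈col
  ...   | i , i∈ , refl = j∈ , i∈

  boxes⁺ : ∀ {j i} → j ∈ cols → i ∈ interval 0 (ζ j) → (j , i) ∈ boxes n L
  boxes⁺ {j} j∈ i∈ = ∈-concatMap⁺ (λ j → map (j ,_) (interval 0 (ζ j))) (lose j∈ (∈-map⁺ (j ,_) i∈))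

  concat-boxes : ∀ F → length F ≡ λ₁ → (∀ {j} → j ∈ cols → length (atD [] F j) ≡ ζ j)
    → concat F ≡ map (entryAt F) (boxes n L)
  concat-boxes F lenF lenCol = begin
    concat F
      ≡⟨ cong concat (sym (trans (cong (map (atD [] F) ∘ interval 0) (sym lenF)) (tabulate-entries [] F))) ⟩
    concat (map (atD [] F) cols)
      ≡⟨ cong concat (map-cong-local (All.tabulate column)) ⟩
    concat (map (λ j → map (entry F j) (interval 0 (ζ j))) cols)
      ≡⟨ cong concat (map-cong (λ j → map-∘ (interval 0 (ζ j))) cols) ⟩
    concat (map (map (entryAt F) ∘ (λ j → map (j ,_) (interval 0 (ζ j)))) cols)
      ≡⟨ sym (map-concatMap (entryAt F) _ cols) ⟩
    map (entryAt F) (boxes n L)  ∎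
    where
    open ≡-Reasoning
    column : ∀ {j} → j ∈ cols → atD [] F j ≡ map (entry F j) (interval 0 (ζ j))
    column {j} j∈ = sym (trans (cong (map (entry F j) ∘ interval 0) (sym (lenCol j∈))) (tabulate-entries 0 (atD [] F j)))

  module Tableau (tab : Filling) (tab∈ : tab ∈ tableaux n L) where

    private
      isTab : T (isTableau n L tab)
      isTab = proj₂ (∈-filter⁻ (T? ∘ isTableau n L) {xs = shapeFillings n L} tab∈)

      positive bounded colOK rowOK : ℕ → ℕ → Bool
      positive j i = 1 ≤ᵇ entry tab j i
      bounded j i = entry tab j i ≤ᵇ n
      colOK j i = not (suc i ≤ᵇ ζ j) ∨ (entry tab j i <ᵇ entry tab j (suc i))
      rowOK j i = not ((suc j ≤ᵇ λ₁) ∧ (i ≤ᵇ ζ (suc j))) ∨ (entry tab j i ≤ᵇ entry tab (suc j) i)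

      boxOK : ∀ {j i} → (j , i) ∈ boxes n L → T (positive j i ∧ bounded j i ∧ colOK j i ∧ rowOK j i)
      boxOK b∈ = All.lookup (AllP.all⁺ _ (boxes n L) (∧-snd (∧-snd {length tab ≡ᵇ λ₁} isTab))) b∈

    length-tab : length tab ≡ λ₁
    length-tab = ≡ᵇ⇒≡ _ _ (∧-fst isTab)

    length-column : ∀ {j} → j ∈ cols → length (atD [] tab j) ≡ ζ j
    length-column j∈ = ≡ᵇ⇒≡ _ _ (All.lookup (AllP.all⁺ _ cols (∧-fst (∧-snd {length tab ≡ᵇ λ₁} isTab))) j∈)

    entry-positive : ∀ {j i} → (j , i) ∈ boxes n L → 1 ≤ entry tab j i
    entry-positive {j} {i} b∈ = ≤ᵇ⇒≤ 1 _ (∧-fst (boxOK b∈))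

    entry-≤n : ∀ {j i} → (j , i) ∈ boxes n L → entry tab j i ≤ n
    entry-≤n {j} {i} b∈ = ≤ᵇ⇒≤ _ n (∧-fst (∧-snd {positive j i} (boxOK b∈)))

    column-strict : ∀ {j i} → (j , i) ∈ boxes n L → suc i ≤ ζ j → entry tab j i < entry tab j (suc i)
    column-strict {j} {i} b∈ below =
      <ᵇ⇒< _ _ (⇒-elim (∧-fst (∧-snd {bounded j i} (∧-snd {positive j i} (boxOK b∈)))) (≤⇒≤ᵇ below))

    entry-≥row : ∀ {j i} → (j , i) ∈ boxes n L → i ≤ entry tab j i
    entry-≥row {j} {zero} b∈ = z≤n
    entry-≥row {j} {suc zero} b∈ = entry-positive b∈
    entry-≥row {j} {suc (suc i)} b∈ = ≤-trans (s≤s (entry-≥row above)) (column-strict above i+2≤ζ)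
      where
      i+2≤ζ = proj₂ (∈-interval⁻ 0 (ζ j) (proj₂ (boxes⁻ b∈)))
      above = boxes⁺ (proj₁ (boxes⁻ b∈)) (∈-interval⁺ 0 (ζ j) (s≤s z≤n) (≤-trans (n≤1+n _) i+2≤ζ))

    concat-tab : concat tab ≡ map (entryAt tab) (boxes n L)
    concat-tab = concat-boxes tab length-tab length-column

    entries-in-range : All (λ x → 1 ≤ x × x ≤ n) (concat tab)
    entries-in-range = subst (All (λ x → 1 ≤ x × x ≤ n)) (sym concat-tab) (All.tabulate in-range)
      where
      in-range : ∀ {x} → x ∈ map (entryAt tab) (boxes n L) → 1 ≤ x × x ≤ n
      in-range x∈ with ∈-map⁻ (entryAt tab) x∈
      ... | (j , i) , b∈ , refl = entry-positive b∈ , entry-≤n b∈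

    entry-≤-scan : ∀ {j i} → (j , i) ∈ boxes n L → entry tab j i ≤ entry (scan n L tab) j i
    entry-≤-scan {j} {i} b∈ = subst₂ _≤_
      (cong (λ col → at col i) (reverse-involutive (atD [] tab j)))
      (cong (λ col → at col i) (sym (atD-tabulate [] (scanCol n L tab) λ₁ j 1≤j j≤λ₁)))
      (Pointwise-at (PW.reverse⁺ bottom-up) i)
      where
      j∈ = proj₁ (boxes⁻ b∈)
      1≤j = proj₁ (∈-interval⁻ 0 λ₁ j∈)
      j≤λ₁ = proj₂ (∈-interval⁻ 0 λ₁ j∈)
      col = atD [] tab j
      length-col : length (reverse col) ≡ ζ j
      length-col = trans (length-reverse col) (length-column j∈)
      bottom-up : Pointwise _≤_ (reverse col) (scanPasses (ζ j) (map reverse (drop (j ∸ 1) tab)))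
      bottom-up = subst₂ (Pointwise _≤_)
        (take-all (ζ j) (reverse col) (≤-reflexive length-col))
        (cong (λ cs → scanPasses (ζ j) (map reverse cs)) (sym (drop-at [] tab j 1≤j (subst (j ≤_) (sym length-tab) j≤λ₁))))
        (scan-≥ (ζ j) (reverse col) (map reverse (drop j tab)) (≤-reflexive (sym length-col)))

count : ℕ → List ℕ → ℕ
count x xs = length (filterᵇ (_≡ᵇ x) xs)

count-++ : ∀ x xs ys → count x (xs ++ ys) ≡ count x xs + count x ys
count-++ x xs ys = trans (cong length (filter-++ (T? ∘ (_≡ᵇ x)) xs ys)) (length-++ (filterᵇ (_≡ᵇ x) xs) {filterᵇ (_≡ᵇ x) ys})

count-∉ : ∀ {x xs} → x ∉ xs → count x xs ≡ 0
count-∉ {x} {xs} x∉ = cong length (filter-none (T? ∘ (_≡ᵇ x))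
  (All.tabulate (λ {y} y∈ y≡ᵇx → x∉ (subst (_∈ xs) (≡ᵇ⇒≡ y x y≡ᵇx) y∈))))

count-∈ : ∀ {x xs} → AllPairs _<_ xs → x ∈ xs → count x xs ≡ 1
count-∈ {x} {.x ∷ ys} (x< ∷ _) (here refl) =
  trans (cong length (filter-accept (T? ∘ (_≡ᵇ x)) {x} {ys} (≡⇒≡ᵇ x x refl)))
        (cong suc (count-∉ (λ x∈ → <-irrefl refl (All.lookup x< x∈))))
count-∈ {x} {y ∷ ys} (y< ∷ inc) (there x∈) =
  trans (cong length (filter-reject (T? ∘ (_≡ᵇ x)) {y} {ys} (λ y≡ᵇx → <-irrefl (≡ᵇ⇒≡ y x y≡ᵇx) (All.lookup y< x∈))))
        (count-∈ inc x∈)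

count-concat : ∀ x (c : ℕ → List ℕ) js → All (λ j → AllPairs _<_ (c j)) js
  → count x (concat (map c js)) ≡ length (filterᵇ (λ j → memb x (c j)) js)
count-concat x c [] [] = refl
count-concat x c (j ∷ js) (inc ∷ incs) with T? (memb x (c j))
... | yes x∈ = begin
  count x (c j ++ concat (map c js))              ≡⟨ count-++ x (c j) _ ⟩
  count x (c j) + count x (concat (map c js))     ≡⟨ cong₂ _+_ (count-∈ inc (memb⇒∈ (c j) x∈)) (count-concat x c js incs) ⟩
  suc (length (filterᵇ (λ j → memb x (c j)) js))  ≡⟨ cong length (sym (filter-accept (T? ∘ λ j → memb x (c j)) {xs = js} x∈)) ⟩
  length (filterᵇ (λ j → memb x (c j)) (j ∷ js))  ∎
  where open ≡-Reasoning
... | no x∉ = begin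
  count x (c j ++ concat (map c js))              ≡⟨ count-++ x (c j) _ ⟩
  count x (c j) + count x (concat (map c js))     ≡⟨ cong₂ _+_ (count-∉ {x} {c j} (x∉ ∘ ∈⇒memb)) (count-concat x c js incs) ⟩
  length (filterᵇ (λ j → memb x (c j)) js)        ≡⟨ cong length (sym (filter-reject (T? ∘ λ j → memb x (c j)) {xs = js} x∉)) ⟩
  length (filterᵇ (λ j → memb x (c j)) (j ∷ js))  ∎
  where open ≡-Reasoning

length-filter-≤ : ∀ m k → k ≤ m → length (filterᵇ (_≤ᵇ k) (interval 0 m)) ≡ k
length-filter-≤ m k k≤m = begin
  length (filterᵇ (_≤ᵇ k) (interval 0 m))
    ≡⟨ cong (length ∘ filterᵇ (_≤ᵇ k)) (interval-++ z≤n k≤m) ⟩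
  length (filterᵇ (_≤ᵇ k) (interval 0 k ++ interval k m))
    ≡⟨ cong length (filter-++ (T? ∘ (_≤ᵇ k)) (interval 0 k) (interval k m)) ⟩
  length (filterᵇ (_≤ᵇ k) (interval 0 k) ++ filterᵇ (_≤ᵇ k) (interval k m))
    ≡⟨ cong₂ (λ xs ys → length (xs ++ ys))
         (filter-all (T? ∘ (_≤ᵇ k)) {xs = interval 0 k} (All.tabulate (λ x∈ → ≤⇒≤ᵇ (proj₂ (∈-interval⁻ 0 k x∈)))))
         (filter-none (T? ∘ (_≤ᵇ k)) {xs = interval k m} (All.tabulate (λ {x} x∈ x≤k → <⇒≱ (proj₁ (∈-interval⁻ k m x∈)) (≤ᵇ⇒≤ x k x≤k)))) ⟩
  length (interval 0 k ++ [])
    ≡⟨ cong length (++-identityʳ (interval 0 k)) ⟩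
  length (interval 0 k)
    ≡⟨ length-segment 0 k ⟩
  k  ∎
  where open ≡-Reasoning

module ColumnFilling (n : ℕ) (L : List ℕ) (c : ℕ → List ℕ)
  (increasing : ∀ {j} → j ∈ Shape.cols n L → AllPairs _<_ (c j))
  (in-range : ∀ {j} → j ∈ Shape.cols n L → All (_∈ interval 0 n) (c j))
  (length-c : ∀ {j} → j ∈ Shape.cols n L → length (c j) ≡ zeta n L j)
  (nested : ∀ {j j'} → j ∈ Shape.cols n L → j' ∈ Shape.cols n L → j ≤ j' → c j' ⊆ c j) where

  open Shape n L

  filling : Filling
  filling = map c cols

  length-filling : length filling ≡ λ₁
  length-filling = trans (length-map c cols) (length-segment 0 λ₁)

  column : ∀ {j} → j ∈ cols → atD [] filling j ≡ c j
  column j∈ = let 1≤j , j≤ = ∈-interval⁻ 0 λ₁ j∈ in atD-tabulate [] c λ₁ _ 1≤j j≤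

  filling-shape : filling ∈ shapeFillings n L
  filling-shape = fillings⁺ n (map ζ cols) filling (pointwise (All.tabulate (λ j∈ → j∈)))
    where
    pointwise : ∀ {js} → All (_∈ cols) js
      → Pointwise (λ col l → length col ≡ l × All (_∈ interval 0 n) col) (map c js) (map ζ js)
    pointwise [] = []
    pointwise (j∈ ∷ js∈) = (length-c j∈ , in-range j∈) ∷ pointwise js∈

  -- The conditions of isTableau at a box: entries in [n] (in-range), columns
  -- strictly increasing (increasing), rows weakly increasing (nested).
  box-conditions : ∀ {j i} → (j , i) ∈ boxes n L
    → T ((1 ≤ᵇ entry filling j i) ∧ (entry filling j i ≤ᵇ n)
         ∧ (not (suc i ≤ᵇ ζ j) ∨ (entry filling j i <ᵇ entry filling j (suc i)))
         ∧ (not ((suc j ≤ᵇ λ₁) ∧ (i ≤ᵇ ζ (suc j))) ∨ (entry filling j i ≤ᵇ entry filling (suc j) i)))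
  box-conditions {j} {i} b∈ =
    ∧-intro (≤⇒≤ᵇ (subst (1 ≤_) (sym e) (proj₁ range)))
    (∧-intro (≤⇒≤ᵇ (subst (_≤ n) (sym e) (proj₂ range)))
    (∧-intro (⇒-intro column-ok) (⇒-intro row-ok)))
    where
    j∈ = proj₁ (boxes⁻ b∈)
    1≤i = proj₁ (∈-interval⁻ 0 (ζ j) (proj₂ (boxes⁻ b∈)))
    i≤ζ = proj₂ (∈-interval⁻ 0 (ζ j) (proj₂ (boxes⁻ b∈)))
    e : entry filling j i ≡ at (c j) i
    e = cong (λ col → at col i) (column j∈)
    range = ∈-interval⁻ 0 n (All.lookup (in-range j∈) (atD-∈ 0 (c j) i 1≤i (subst (i ≤_) (sym (length-c j∈)) i≤ζ)))
    column-ok : T (suc i ≤ᵇ ζ j) → T (entry filling j i <ᵇ entry filling j (suc i))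
    column-ok below = <⇒<ᵇ (subst₂ _<_ (sym e) (cong (λ col → at col (suc i)) (sym (column j∈)))
      (AllPairs⇒at (c j) (increasing j∈) i (suc i) 1≤i ≤-refl (subst (suc i ≤_) (sym (length-c j∈)) (≤ᵇ⇒≤ _ _ below))))
    row-ok : T ((suc j ≤ᵇ λ₁) ∧ (i ≤ᵇ ζ (suc j))) → T (entry filling j i ≤ᵇ entry filling (suc j) i)
    row-ok right = ≤⇒≤ᵇ (subst₂ _≤_ (sym e) (cong (λ col → at col i) (sym (column j+1∈)))
      (sublist-at (c j) (c (suc j)) (increasing j∈) (increasing j+1∈) (nested j∈ j+1∈ (n≤1+n j)) i 1≤i
        (subst (i ≤_) (sym (length-c j+1∈)) (≤ᵇ⇒≤ i _ (∧-snd right)))))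
      where
      j+1∈ = ∈-interval⁺ 0 λ₁ (s≤s z≤n) (≤ᵇ⇒≤ (suc j) λ₁ (∧-fst right))

  filling-tableau : filling ∈ tableaux n L
  filling-tableau = ∈-filter⁺ (T? ∘ isTableau n L) filling-shape
    (∧-intro (≡⇒≡ᵇ _ _ length-filling)
      (∧-intro (AllP.all⁻ _ {cols} (All.tabulate (λ j∈ → ≡⇒≡ᵇ _ _ (trans (cong length (column j∈)) (length-c j∈)))))
               (AllP.all⁻ _ {boxes n L} (All.tabulate (λ { {j , i} b∈ → box-conditions b∈ })))))

  nested-from : ∀ {j} → j ∈ cols → Nested (reverse (c j)) (map reverse (map c (interval j λ₁)))
  nested-from {j} j∈ = record
    { decreasing = reverse-decreasing (increasing j∈)
    ; decreasing-right = AllP.map⁺ (AllP.map⁺ (All.tabulate (λ k∈ → reverse-decreasing (increasing (right-col k∈)))))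
    ; inside = AllP.map⁺ (AllP.map⁺ (All.tabulate (λ k∈ → reversed-⊆ (nested j∈ (right-col k∈) (<⇒≤ (proj₁ (∈-interval⁻ j λ₁ k∈)))))))
    ; chain = AllPairsP.map⁺ (AllPairsP.map⁺ (all-pairs (segment-sorted j (λ₁ ∸ j)) (All.tabulate right-col)))
    }
    where
    right-col : ∀ {k} → k ∈ interval j λ₁ → k ∈ cols
    right-col k∈ = let j<k , k≤ = ∈-interval⁻ j λ₁ k∈ in ∈-interval⁺ 0 λ₁ (≤-trans (s≤s z≤n) j<k) k≤
    reversed-⊆ : ∀ {xs ys : List ℕ} → ys ⊆ xs → reverse ys ⊆ reverse xs
    reversed-⊆ ys⊆ = AnyP.reverse⁺ ∘ ys⊆ ∘ AnyP.reverse⁻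
    all-pairs : ∀ {ks} → AllPairs _<_ ks → All (_∈ cols) ks → AllPairs (λ k k' → reverse (c k') ⊆ reverse (c k)) ks
    all-pairs [] [] = []
    all-pairs (k< ∷ inc) (k∈ ∷ ks∈) =
      All.zipWith (λ { (k<k' , k'∈) x∈ → reversed-⊆ (nested k∈ k'∈ (<⇒≤ k<k')) x∈ }) (k< , ks∈) ∷ all-pairs inc ks∈

  -- Each column is recovered by scanning it together with the nested columns to its right.
  scan-filling : scan n L filling ≡ filling
  scan-filling = map-cong-local (All.tabulate scan-column)
    where
    scan-column : ∀ {j} → j ∈ cols → scanCol n L filling j ≡ c j
    scan-column {j} j∈ = begin
      reverse (scanPasses (ζ j) (map reverse (drop (j ∸ 1) filling)))
        ≡⟨ cong (λ cs → reverse (scanPasses (ζ j) (map reverse cs))) columns-from-j ⟩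
      reverse (scanPasses (ζ j) (reverse (c j) ∷ map reverse (map c (interval j λ₁))))
        ≡⟨ cong (λ k → reverse (scanPasses k (reverse (c j) ∷ map reverse (map c (interval j λ₁))))) (sym (trans (length-reverse (c j)) (length-c j∈))) ⟩
      reverse (scanPasses (length (reverse (c j))) (reverse (c j) ∷ map reverse (map c (interval j λ₁))))
        ≡⟨ cong reverse (scan-nested (reverse (c j)) _ (nested-from j∈)) ⟩
      reverse (reverse (c j))
        ≡⟨ reverse-involutive (c j) ⟩
      c j  ∎
      where
      open ≡-Reasoning
      1≤j = proj₁ (∈-interval⁻ 0 λ₁ j∈)
      j≤ = proj₂ (∈-interval⁻ 0 λ₁ j∈)
      columns-from-j : drop (j ∸ 1) filling ≡ c j ∷ map c (interval j λ₁)
      columns-from-j = begin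
        drop (j ∸ 1) filling            ≡⟨ drop-at [] filling j 1≤j (subst (j ≤_) (sym length-filling) j≤) ⟩
        atD [] filling j ∷ drop j filling ≡⟨ cong₂ _∷_ (column j∈) (drop-map j cols) ⟩
        c j ∷ map c (drop j cols)       ≡⟨ cong (λ ks → c j ∷ map c ks) (drop-segment 0 λ₁ j) ⟩
        c j ∷ map c (interval j λ₁)     ∎

  count-filling : ∀ x k → k ≤ λ₁ → (∀ {j} → j ∈ cols → (x ∈ c j → j ≤ k) × (j ≤ k → x ∈ c j))
    → count x (concat filling) ≡ k
  count-filling x k k≤λ₁ columns-of-x = begin
    count x (concat filling)                       ≡⟨ count-concat x c cols (All.tabulate increasing) ⟩
    length (filterᵇ (λ j → memb x (c j)) cols)     ≡⟨ cong length (filter-cong-local _ (_≤ᵇ k) cols agree) ⟩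
    length (filterᵇ (_≤ᵇ k) cols)                  ≡⟨ length-filter-≤ λ₁ k k≤λ₁ ⟩
    k                                              ∎
    where
    open ≡-Reasoning
    agree : ∀ {j} → j ∈ cols → (T (memb x (c j)) → T (j ≤ᵇ k)) × (T (j ≤ᵇ k) → T (memb x (c j)))
    agree {j} j∈ = (λ x∈ → ≤⇒≤ᵇ (proj₁ (columns-of-x j∈) (memb⇒∈ (c j) x∈)))
                 , (λ j≤k → ∈⇒memb (proj₂ (columns-of-x j∈) (≤ᵇ⇒≤ j k j≤k)))

module PermutationOf (n : ℕ) (π : List ℕ) (perm : π ↭ interval 0 n) where

  unique : Unique π
  unique = PermS.Unique-resp-↭ (setoid ℕ) (↭⇒↭ₛ (↭-sym perm)) (AllPairs.map <⇒≢ (segment-sorted 0 n))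

  length-π : length π ≡ n
  length-π = trans (↭-length perm) (length-segment 0 n)

  entry-range : ∀ {i} → 1 ≤ i → i ≤ n → 1 ≤ at π i × at π i ≤ n
  entry-range {i} 1≤i i≤n = ∈-interval⁻ 0 n (∈-resp-↭ perm (atD-∈ 0 π i 1≤i (subst (i ≤_) (sym length-π) i≤n)))

  private
    take-drop-disjoint : ∀ {x} z (xs : List ℕ) → Unique xs → x ∈ take z xs → x ∈ drop z xs → ⊥
    take-drop-disjoint (suc z) (y ∷ ys) (y≢ ∷ _) (here refl) x∈drop = All.lookup y≢ (drop-⊆ z ys x∈drop) refl
      where
      drop-⊆ : ∀ z (xs : List ℕ) → drop z xs ⊆ xs
      drop-⊆ zero xs x∈ = x∈
      drop-⊆ (suc z) (y ∷ ys) x∈ = there (drop-⊆ z ys x∈)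
    take-drop-disjoint (suc z) (y ∷ ys) (_ ∷ u) (there x∈take) x∈drop = take-drop-disjoint z ys u x∈take x∈drop

    at-take : ∀ (xs : List ℕ) z i → 1 ≤ i → i ≤ z → i ≤ length xs → at xs i ∈ take z xs
    at-take (y ∷ ys) (suc z) (suc zero) _ _ _ = here refl
    at-take (y ∷ ys) (suc z) (suc (suc i)) _ (s≤s i≤z) (s≤s i≤) = there (at-take ys z (suc i) (s≤s z≤n) i≤z i≤)

    at-drop : ∀ (xs : List ℕ) z i → z < i → i ≤ length xs → at xs i ∈ drop z xs
    at-drop (y ∷ ys) zero (suc zero) _ _ = here refl
    at-drop (y ∷ ys) zero (suc (suc i)) _ (s≤s i≤) = there (at-drop ys zero (suc i) (s≤s z≤n) i≤)
    at-drop (y ∷ ys) (suc z) (suc (suc i)) (s≤s z<i) (s≤s i≤) = at-drop ys z (suc i) z<i i≤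

  ∈-take⁺ : ∀ {i} z → 1 ≤ i → i ≤ n → i ≤ z → at π i ∈ take z π
  ∈-take⁺ {i} z 1≤i i≤n i≤z = at-take π z i 1≤i i≤z (subst (i ≤_) (sym length-π) i≤n)

  ∈-take⁻ : ∀ {i} z → 1 ≤ i → i ≤ n → at π i ∈ take z π → i ≤ z
  ∈-take⁻ {i} z 1≤i i≤n π_i∈ with i ≤? z
  ... | yes i≤z = i≤z
  ... | no i≰z = ⊥-elim (take-drop-disjoint z π unique π_i∈ (at-drop π z i (≰⇒> i≰z) (subst (i ≤_) (sym length-π) i≤n)))

  length-Ycol-take : ∀ z → z ≤ n → length (Ycol n (take z π)) ≡ z
  length-Ycol-take z z≤ = begin
    length (Ycol n (take z π))
      ≡⟨ ↭-length (filter-↭ (T? ∘ inTake) (↭-sym perm)) ⟩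
    length (filterᵇ inTake π)
      ≡⟨ cong (length ∘ filterᵇ inTake) (sym (take++drop≡id z π)) ⟩
    length (filterᵇ inTake (take z π ++ drop z π))
      ≡⟨ cong length (filter-++ (T? ∘ inTake) (take z π) (drop z π)) ⟩
    length (filterᵇ inTake (take z π) ++ filterᵇ inTake (drop z π))
      ≡⟨ cong₂ (λ xs ys → length (xs ++ ys))
           (filter-all (T? ∘ inTake) {xs = take z π} (All.tabulate ∈⇒memb))
           (filter-none (T? ∘ inTake) {xs = drop z π} (All.tabulate (λ x∈drop x∈take → take-drop-disjoint z π unique (memb⇒∈ (take z π) x∈take) x∈drop))) ⟩
    length (take z π ++ [])
      ≡⟨ cong length (++-identityʳ (take z π)) ⟩
    length (take z π)
      ≡⟨ length-take z π ⟩
    z ⊓ length π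
      ≡⟨ m≤n⇒m⊓n≡m (subst (z ≤_) (sym length-π) z≤) ⟩
    z  ∎
    where
    open ≡-Reasoning
    inTake : ℕ → Bool
    inTake k = memb k (take z π)

Ycol-increasing : ∀ n B → AllPairs _<_ (Ycol n B)
Ycol-increasing n B = AllPairsP.filter⁺ (T? ∘ λ k → memb k B) (segment-sorted 0 n)

Ycol-range : ∀ n B → All (_∈ interval 0 n) (Ycol n B)
Ycol-range n B = All.tabulate (λ x∈ → proj₁ (∈-filter⁻ (T? ∘ λ k → memb k B) {xs = interval 0 n} x∈))

Ycol-mono : ∀ n {B B'} → B ⊆ B' → Ycol n B ⊆ Ycol n B'
Ycol-mono n {B} {B'} B⊆ x∈ with ∈-filter⁻ (T? ∘ λ k → memb k B) {xs = interval 0 n} x∈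
... | x∈[n] , x∈B = ∈-filter⁺ (T? ∘ λ k → memb k B') x∈[n] (∈⇒memb (B⊆ (memb⇒∈ B x∈B)))

∈-Ycol⁻ : ∀ {n B x} → x ∈ Ycol n B → x ∈ B
∈-Ycol⁻ {n} {B} x∈ = memb⇒∈ B (proj₂ (∈-filter⁻ (T? ∘ λ k → memb k B) {xs = interval 0 n} x∈))

∈-Ycol⁺ : ∀ {n B x} → 1 ≤ x → x ≤ n → x ∈ B → x ∈ Ycol n B
∈-Ycol⁺ {n} {B} 1≤x x≤n x∈ = ∈-filter⁺ (T? ∘ λ k → memb k B) (∈-interval⁺ 0 n 1≤x x≤n) (∈⇒memb x∈)

module KeyTableau (m : ℕ) (L : List ℕ) (P : Partition L) (π : List ℕ) (perm : π ↭ interval 0 (suc m)) where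

  open Breakpoints m L P using (n; ζ; ζ≤n; ζ-antitone; in-shape⇒; in-shape⇐)
  open KeyColumns m L P π using (keyColumn; key-columns)
  open PermutationOf n π perm
  open Shape n L using (cols; λ₁)

  open ColumnFilling n L (keyColumn ∘ ζ)
    (λ {j} _ → Ycol-increasing n (take (ζ j) π)) (λ {j} _ → Ycol-range n (take (ζ j) π))
    (λ {j} _ → length-Ycol-take (ζ j) (ζ≤n j))
    (λ _ _ j≤j' → Ycol-mono n (take-⊆ π (ζ-antitone j≤j')))
    public

  content-key : ∀ i → 1 ≤ i → i ≤ n → count (at π i) (concat filling) ≡ at L i
  content-key i 1≤i i≤n = count-filling (at π i) (at L i) (P 1 i ≤-refl 1≤i) (λ {j} _ →
      (λ π_i∈ → in-shape⇐ 1≤i i≤n (∈-take⁻ (ζ j) 1≤i i≤n (∈-Ycol⁻ π_i∈)))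
    , (λ j≤λ_i → ∈-Ycol⁺ (proj₁ (entry-range 1≤i i≤n)) (proj₂ (entry-range 1≤i i≤n))
                   (∈-take⁺ (ζ j) 1≤i i≤n (in-shape⇒ 1≤i i≤n j≤λ_i))))

  key-filling : at L (suc n) ≡ 0 → key n L π ≡ filling
  key-filling λn+1≡0 = key-columns λn+1≡0 perm

module MinimalTableau (n : ℕ) (L : List ℕ) (P : Partition L) where

  open ColumnLengths n L P
  open Shape n L using (cols)

  private
    initial-segment-⊆ : ∀ {z' z} → z' ≤ z → interval 0 z' ⊆ interval 0 z
    initial-segment-⊆ {z'} {z} z'≤z x∈ = let 1≤x , x≤ = ∈-interval⁻ 0 z' x∈ in ∈-interval⁺ 0 z 1≤x (≤-trans x≤ z'≤z)

  open ColumnFilling n L (λ j → interval 0 (ζ j))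
    (λ {j} _ → segment-sorted 0 (ζ j)) (λ {j} _ → All.tabulate (initial-segment-⊆ (ζ≤n j)))
    (λ {j} _ → length-segment 0 (ζ j)) (λ _ _ j≤j' → initial-segment-⊆ (ζ-antitone j≤j'))
    public

  entry-minimal : ∀ {j i} → (j , i) ∈ boxes n L → entry filling j i ≡ i
  entry-minimal {j} {zero} b∈ with proj₁ (∈-interval⁻ 0 (ζ j) (proj₂ (Shape.boxes⁻ n L b∈)))
  ... | ()
  entry-minimal {j} {suc i} b∈ with Shape.boxes⁻ n L b∈
  ... | j∈ , i∈ = trans (cong (λ col → at col (suc i)) (column j∈))
                        (atD-applyUpTo 0 suc (ζ j) i (proj₂ (∈-interval⁻ 0 (ζ j) i∈)))

  content-minimal : ∀ i → 1 ≤ i → i ≤ n → count i (concat filling) ≡ at L i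
  content-minimal i 1≤i i≤n = count-filling i (at L i) (P 1 i ≤-refl 1≤i) (λ {j} _ →
      (λ i∈ → in-shape⇐ 1≤i i≤n (proj₂ (∈-interval⁻ 0 (ζ j) i∈)))
    , (λ j≤λ_i → ∈-interval⁺ 0 (ζ j) 1≤i (in-shape⇒ 1≤i i≤n j≤λ_i)))

countUpTo : ℕ → List ℕ → ℕ
countUpTo k xs = length (filterᵇ (_≤ᵇ k) xs)

countUpTo-suc : ∀ k xs → countUpTo (suc k) xs ≡ countUpTo k xs + count (suc k) xs
countUpTo-suc k [] = refl
countUpTo-suc k (x ∷ xs) with <-cmp x (suc k)
... | tri< x<k+1 _ _ rewrite ≤ᵇ-eval (<⇒≤ x<k+1) | ≤ᵇ-eval (≤-pred x<k+1) | ≡ᵇ-eval-≢ (<⇒≢ x<k+1) =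
  cong suc (countUpTo-suc k xs)
... | tri≈ _ refl _ rewrite ≤ᵇ-eval (≤-refl {suc k}) | ≤ᵇ-eval-> (n<1+n k) | ≡ᵇ-eval-≡ (suc k) =
  trans (cong suc (countUpTo-suc k xs)) (sym (+-suc _ _))
... | tri> _ _ k+1<x rewrite ≤ᵇ-eval-> k+1<x | ≤ᵇ-eval-> (<-trans (n<1+n k) k+1<x) | ≡ᵇ-eval-≢ (≢-sym (<⇒≢ k+1<x)) =
  countUpTo-suc k xs

countUpTo-zero : ∀ xs → All (1 ≤_) xs → countUpTo 0 xs ≡ 0
countUpTo-zero [] _ = refl
countUpTo-zero (suc x ∷ xs) (_ ∷ pos) = countUpTo-zero xs pos

countUpTo-antitone : ∀ k {xs ys} → Pointwise _≤_ xs ys → countUpTo k ys ≤ countUpTo k xs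
countUpTo-antitone k [] = z≤n
countUpTo-antitone k {x ∷ xs} {y ∷ ys} (x≤y ∷ rest) with y ≤ᵇ k in y≤ᵇk
... | true rewrite ≤ᵇ-eval (≤-trans x≤y (≤ᵇ-true y≤ᵇk)) = s≤s (countUpTo-antitone k rest)
... | false with x ≤ᵇ k
...   | true = m≤n⇒m≤1+n (countUpTo-antitone k rest)
...   | false = countUpTo-antitone k rest

counts⇒countUpTo : ∀ n xs ys → All (λ x → 1 ≤ x × x ≤ n) xs → All (λ x → 1 ≤ x × x ≤ n) ys
  → (∀ m → 1 ≤ m → m ≤ n → count m xs ≡ count m ys) → ∀ k → countUpTo k xs ≡ countUpTo k ys
counts⇒countUpTo n xs ys xs∈ ys∈ same zero =
  trans (countUpTo-zero xs (All.map proj₁ xs∈)) (sym (countUpTo-zero ys (All.map proj₁ ys∈)))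
counts⇒countUpTo n xs ys xs∈ ys∈ same (suc k) = begin
  countUpTo (suc k) xs                      ≡⟨ countUpTo-suc k xs ⟩
  countUpTo k xs + count (suc k) xs         ≡⟨ cong₂ _+_ (counts⇒countUpTo n xs ys xs∈ ys∈ same k) same-count ⟩
  countUpTo k ys + count (suc k) ys         ≡⟨ sym (countUpTo-suc k ys) ⟩
  countUpTo (suc k) ys                      ∎
  where
  open ≡-Reasoning
  absent : ∀ {zs} → All (λ x → 1 ≤ x × x ≤ n) zs → n < suc k → count (suc k) zs ≡ 0
  absent zs∈ n<k+1 = count-∉ (λ k+1∈ → <⇒≱ n<k+1 (proj₂ (All.lookup zs∈ k+1∈)))
  same-count : count (suc k) xs ≡ count (suc k) ys
  same-count with suc k ≤? n
  ... | yes k+1≤n = same (suc k) (s≤s z≤n) k+1≤n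
  ... | no k+1≰n = trans (absent xs∈ (≰⇒> k+1≰n)) (sym (absent ys∈ (≰⇒> k+1≰n)))

countUpTo⇒counts : ∀ xs ys → (∀ k → countUpTo k xs ≡ countUpTo k ys) → ∀ m → count (suc m) xs ≡ count (suc m) ys
countUpTo⇒counts xs ys same m = +-cancelˡ-≡ (countUpTo m xs) _ _ (begin
  countUpTo m xs + count (suc m) xs     ≡⟨ sym (countUpTo-suc m xs) ⟩
  countUpTo (suc m) xs                  ≡⟨ same (suc m) ⟩
  countUpTo (suc m) ys                  ≡⟨ countUpTo-suc m ys ⟩
  countUpTo m ys + count (suc m) ys     ≡⟨ cong (_+ count (suc m) ys) (sym (same m)) ⟩
  countUpTo m xs + count (suc m) ys     ∎)
  where open ≡-Reasoning

listEq-refl : ∀ xs → T (listEq xs xs)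
listEq-refl [] = tt
listEq-refl (x ∷ xs) = ∧-intro (≡⇒≡ᵇ x x refl) (listEq-refl xs)

listEq-sound : ∀ xs ys → T (listEq xs ys) → xs ≡ ys
listEq-sound [] [] _ = refl
listEq-sound (x ∷ xs) (y ∷ ys) eq = cong₂ _∷_ (≡ᵇ⇒≡ x y (∧-fst eq)) (listEq-sound xs ys (∧-snd {x ≡ᵇ y} eq))

genPoly-positive : ∀ n S F → F ∈ S → 1 ≤ genPoly n S (content n F)
genPoly-positive n S F F∈ =
  filter-some (T? ∘ λ G → listEq (content n G) (content n F)) (lose F∈ (listEq-refl (content n F)))

genPoly-witness : ∀ n S θ → 1 ≤ genPoly n S θ → Σ Filling λ G → G ∈ S × content n G ≡ θ
genPoly-witness n S θ pos with filterᵇ (λ G → listEq (content n G) θ) S in eq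
... | G ∷ _ with ∈-filter⁻ (T? ∘ λ G → listEq (content n G) θ) {xs = S} (subst (G ∈_) (sym eq) (here refl))
...   | G∈ , same = G , G∈ , listEq-sound _ _ same

same-content : ∀ n S S' → genPoly n S ≈Poly genPoly n S' → ∀ F → F ∈ S
  → Σ Filling λ G → G ∈ S' × content n G ≡ content n F
same-content n S S' same F F∈ =
  genPoly-witness n S' (content n F) (subst (1 ≤_) (same (content n F)) (genPoly-positive n S F F∈))

count-content : ∀ n F G → content n F ≡ content n G → ∀ m → 1 ≤ m → m ≤ n → count m (concat F) ≡ count m (concat G)
count-content n F G same m 1≤m m≤n = begin
  count m (concat F)                          ≡⟨ sym (atD-tabulate 0 (λ i → count i (concat F)) n m 1≤m m≤n) ⟩
  at (content n F) m                          ≡⟨ cong (λ θ → at θ m) same ⟩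
  at (content n G) m                          ≡⟨ atD-tabulate 0 (λ i → count i (concat G)) n m 1≤m m≤n ⟩
  count m (concat G)                          ∎
  where open ≡-Reasoning

entrywise⇒countUpTo : ∀ n L U V → U ∈ tableaux n L → V ∈ tableaux n L
  → (∀ {j i} → (j , i) ∈ boxes n L → entry U j i ≤ entry V j i)
  → ∀ k → countUpTo k (concat V) ≤ countUpTo k (concat U)
entrywise⇒countUpTo n L U V U∈ V∈ U≤V k =
  subst₂ (λ u v → countUpTo k v ≤ countUpTo k u)
    (sym (Shape.Tableau.concat-tab n L U U∈)) (sym (Shape.Tableau.concat-tab n L V V∈))
    (countUpTo-antitone k (pointwise (boxes n L) (λ b∈ → U≤V b∈)))
  where
  pointwise : ∀ bs → (∀ {b} → b ∈ bs → entryAt U b ≤ entryAt V b) → Pointwise _≤_ (map (entryAt U) bs) (map (entryAt V) bs)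
  pointwise [] _ = []
  pointwise ((j , i) ∷ bs) le = le (here refl) ∷ pointwise bs (le ∘ there)

content⇒countUpTo : ∀ n L L' U V → U ∈ tableaux n L → V ∈ tableaux n L' → content n U ≡ content n V
  → ∀ k → countUpTo k (concat U) ≡ countUpTo k (concat V)
content⇒countUpTo n L L' U V U∈ V∈ same =
  counts⇒countUpTo n (concat U) (concat V)
    (Shape.Tableau.entries-in-range n L U U∈) (Shape.Tableau.entries-in-range n L' V V∈) (count-content n U V same)

module FlaggedSchur {n : ℕ} where

  private
    module T₀ (lam : Vec ℕ n) (P : IsPartition lam) = MinimalTableau n (PartitionVec.L lam P) (PartitionVec.partition lam P)

  flag-≥ : ∀ (lam β : Vec ℕ n) → InU lam β → ∀ i → 1 ≤ i → i ≤ n → i ≤ at (toList β) i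
  flag-≥ lam β U (suc i) _ i<n = subst₂ _≤_ (cong suc (FinP.toℕ-fromℕ< i<n)) (sym (at-toList-fromℕ< β i<n))
    (proj₁ (U (Fin.fromℕ< i<n)))

  -- T₀(λ) ∈ 𝒮_λ(β): its entry in row i is i ≤ β_i.
  minimal-flagged : ∀ lam P β → InU lam β → T₀.filling lam P ∈ flaggedSet n (toList lam) (toList β)
  minimal-flagged lam P β U = ∈-filter⁺ _ (T₀.filling-tableau lam P)
    (AllP.all⁻ _ {boxes n (toList lam)} (All.tabulate (λ { {j , i} b∈ → ≤⇒≤ᵇ (flagged b∈) })))
    where
    flagged : ∀ {j i} → (j , i) ∈ boxes n (toList lam) → entry (T₀.filling lam P) j i ≤ at (toList β) i
    flagged {j} {i} b∈ = let j∈ , i∈ = Shape.boxes⁻ n (toList lam) b∈ ; 1≤i , i≤ζ = ∈-interval⁻ 0 _ i∈ in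
      subst (_≤ at (toList β) i) (sym (T₀.entry-minimal lam P b∈))
        (flag-≥ lam β U i 1≤i (≤-trans i≤ζ (ColumnLengths.ζ≤n n (toList lam) (PartitionVec.partition lam P) j)))

  -- The content λ of T₀(λ) is realised by a tableau of shape λ', which lies above T₀(λ').
  minimal-countUpTo-≤ : ∀ lam lam' P P' β β' → InU lam β → sPoly lam β ≈Poly sPoly lam' β'
    → ∀ k → countUpTo k (concat (T₀.filling lam P)) ≤ countUpTo k (concat (T₀.filling lam' P'))
  minimal-countUpTo-≤ lam lam' P P' β β' U same k with same-content n _ _ same _ (minimal-flagged lam P β U)
  ... | G , G∈ , content-G = subst (_≤ countUpTo k (concat (T₀.filling lam' P')))
      (content⇒countUpTo n (toList lam') (toList lam) G (T₀.filling lam P) G-tableau (T₀.filling-tableau lam P) content-G k)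
      (entrywise⇒countUpTo n (toList lam') _ G (T₀.filling-tableau lam' P') G-tableau above k)
    where
    G-tableau : G ∈ tableaux n (toList lam')
    G-tableau = proj₁ (∈-filter⁻ _ {xs = tableaux n (toList lam')} G∈)
    above : ∀ {j i} → (j , i) ∈ boxes n (toList lam') → entry (T₀.filling lam' P') j i ≤ entry G j i
    above b∈ = subst (_≤ _) (sym (T₀.entry-minimal lam' P' b∈)) (Shape.Tableau.entry-≥row n (toList lam') G G-tableau b∈)

  shape-determined : ∀ lam lam' (P : IsPartition lam) (P' : IsPartition lam') β β' → InU lam β → InU lam' β'
    → sPoly lam β ≈Poly sPoly lam' β' → lam ≡ lam'
  shape-determined lam lam' P P' β β' U U' same = Vec-ext lam lam' (λ i 1≤i i≤n → begin
    at (toList lam) i                      ≡⟨ sym (T₀.content-minimal lam P i 1≤i i≤n) ⟩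
    count i (concat (T₀.filling lam P))    ≡⟨ same-counts i 1≤i ⟩
    count i (concat (T₀.filling lam' P'))  ≡⟨ T₀.content-minimal lam' P' i 1≤i i≤n ⟩
    at (toList lam') i                     ∎)
    where
    open ≡-Reasoning
    same-counts : ∀ i → 1 ≤ i → count i (concat (T₀.filling lam P)) ≡ count i (concat (T₀.filling lam' P'))
    same-counts (suc i) _ = countUpTo⇒counts (concat (T₀.filling lam P)) (concat (T₀.filling lam' P')) (λ k →
      ≤-antisym (minimal-countUpTo-≤ lam lam' P P' β β' U same k) (minimal-countUpTo-≤ lam' lam P' P β' β U' (sym ∘ same) k)) i

module WeightOrder (θ : ℕ → ℕ) where

  _≺_ : ℕ → ℕ → Set
  a ≺ b = θ b < θ a ⊎ (θ a ≡ θ b × a < b)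

  ≺-asym : ∀ {a b} → a ≺ b → b ≺ a → ⊥
  ≺-asym (inj₁ lt) (inj₁ gt) = <-asym lt gt
  ≺-asym (inj₁ lt) (inj₂ (eq , _)) = <-irrefl eq lt
  ≺-asym (inj₂ (eq , _)) (inj₁ gt) = <-irrefl eq gt
  ≺-asym (inj₂ (_ , lt)) (inj₂ (_ , gt)) = <-asym lt gt

  sorted-unique : ∀ xs ys → AllPairs _≺_ xs → AllPairs _≺_ ys → xs ↭ ys → xs ≡ ys
  sorted-unique [] [] _ _ _ = refl
  sorted-unique [] (y ∷ ys) _ _ p with ↭-length p
  ... | ()
  sorted-unique (x ∷ xs) [] _ _ p with ↭-length p
  ... | ()
  sorted-unique (x ∷ xs) (y ∷ ys) (x≺ ∷ sorted-xs) (y≺ ∷ sorted-ys) p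
    with ∈-resp-↭ p (here refl) | ∈-resp-↭ (↭-sym p) (here refl)
  ... | here refl | _ = cong (x ∷_) (sorted-unique xs ys sorted-xs sorted-ys (drop-∷ p))
  ... | there _ | here refl = cong (x ∷_) (sorted-unique xs ys sorted-xs sorted-ys (drop-∷ p))
  ... | there x∈ys | there y∈xs = ⊥-elim (≺-asym (All.lookup y≺ x∈ys) (All.lookup x≺ y∈xs))

module Demazure (m : ℕ) where

  n : ℕ
  n = suc m

  private
    module Y (lam : Vec ℕ n) (P : IsPartition lam) (π : Vec ℕ n) (perm : toList π ↭ interval 0 n) =
      KeyTableau m (PartitionVec.L lam P) (PartitionVec.partition lam P) (toList π) perm

  key≡filling : ∀ lam P π perm → key n (toList lam) (toList π) ≡ Y.filling lam P π perm
  key≡filling lam P π perm = Y.key-filling lam P π perm (PartitionVec.beyond lam P)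

  -- Y_λ(π) is a tableau with S(Y) = Y, so it belongs to 𝒟_λ(π).
  key-in-demazure : ∀ lam P π perm → Y.filling lam P π perm ∈ demazureSet lam π
  key-in-demazure lam P π perm = ∈-filter⁺ _ (Y.filling-tableau lam P π perm)
    (subst₂ (λ s k → T (leqTab n (toList lam) s k)) (sym (Y.scan-filling lam P π perm)) (sym (key≡filling lam P π perm))
      (AllP.all⁻ _ {boxes n (toList lam)} (All.tabulate (λ { {j , i} _ → ≤⇒≤ᵇ (≤-refl {entry (Y.filling lam P π perm) j i}) }))))

  -- The content of Y_λ(π) is realised by some T ∈ 𝒟_λ'(π'), and T ≤ S(T) ≤ Y_λ'(π').
  key-countUpTo-≤ : ∀ lam lam' P P' π π' perm perm' → dPoly lam π ≈Poly dPoly lam' π'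
    → ∀ k → countUpTo k (concat (Y.filling lam' P' π' perm')) ≤ countUpTo k (concat (Y.filling lam P π perm))
  key-countUpTo-≤ lam lam' P P' π π' perm perm' same k with same-content n _ _ same _ (key-in-demazure lam P π perm)
  ... | G , G∈ , content-G = subst (countUpTo k (concat Y') ≤_)
      (content⇒countUpTo n (toList lam') (toList lam) G (Y.filling lam P π perm) G-tableau (Y.filling-tableau lam P π perm) content-G k)
      (entrywise⇒countUpTo n (toList lam') G Y' G-tableau (Y.filling-tableau lam' P' π' perm') below k)
    where
    Y' = Y.filling lam' P' π' perm'
    G-tableau : G ∈ tableaux n (toList lam')
    G-tableau = proj₁ (∈-filter⁻ _ {xs = tableaux n (toList lam')} G∈)
    scan-below-key : ∀ {j i} → (j , i) ∈ boxes n (toList lam') → entry (scan n (toList lam') G) j i ≤ entry Y' j i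
    scan-below-key {j} {i} b∈ = subst (λ y → entry (scan n (toList lam') G) j i ≤ entry y j i) (key≡filling lam' P' π' perm')
      (≤ᵇ⇒≤ _ _ (All.lookup (AllP.all⁺ _ (boxes n (toList lam')) (proj₂ (∈-filter⁻ _ {xs = tableaux n (toList lam')} G∈))) b∈))
    below : ∀ {j i} → (j , i) ∈ boxes n (toList lam') → entry G j i ≤ entry Y' j i
    below b∈ = ≤-trans (Shape.Tableau.entry-≤-scan n (toList lam') G G-tableau b∈) (scan-below-key b∈)

  sorted-by-weight : ∀ lam (P : IsPartition lam) π → InSnλ lam π → (θ : ℕ → ℕ)
    → (∀ i → 1 ≤ i → i ≤ n → θ (at (toList π) i) ≡ at (toList lam) i)
    → AllPairs (WeightOrder._≺_ θ) (toList π)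
  sorted-by-weight lam P π Sπ θ weight = at⇒AllPairs (toList π) ordered
    where
    open PartitionVec lam P using (L; partition)
    open Breakpoints m L partition using (carrel-of)
    ordered : ∀ i k → 1 ≤ i → i < k → k ≤ length (toList π) → WeightOrder._≺_ θ (at (toList π) i) (at (toList π) k)
    ordered i k 1≤i i<k k≤ = compare (at L k <? at L i)
      where
      k≤n = subst (k ≤_) (VecP.length-toList π) k≤
      weight-i = weight i 1≤i (≤-trans (<⇒≤ i<k) k≤n)
      weight-k = weight k (≤-trans 1≤i (<⇒≤ i<k)) k≤n
      compare : Dec (at L k < at L i) → WeightOrder._≺_ θ (at (toList π) i) (at (toList π) k)
      compare (yes drop) = inj₁ (subst₂ _<_ (sym weight-k) (sym weight-i) drop)
      compare (no no-drop) = inj₂ (trans weight-i (trans λi≡λk (sym weight-k)) , increasing-in-carrel)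
        where
        λi≡λk = ≤-antisym (≮⇒≥ no-drop) (partition i k 1≤i (<⇒≤ i<k))
        increasing-in-carrel : at (toList π) i < at (toList π) k
        increasing-in-carrel with carrel-of 1≤i i<k k≤n λi≡λk
        ... | (a , b) , ab∈ , a<i , k≤b = proj₂ Sπ a b ab∈ i k a<i i<k k≤b

  -- The two keys have the same content θ, which determines π and then λ.
  shape-and-permutation-determined : ∀ lam lam' (P : IsPartition lam) (P' : IsPartition lam') π π'
    → InSnλ lam π → InSnλ lam' π' → dPoly lam π ≈Poly dPoly lam' π' → lam ≡ lam' × π ≡ π'
  shape-and-permutation-determined lam lam' P P' π π' Sπ Sπ' same = λ≡λ' , π≡π'
    where
    Yλ = Y.filling lam P π (proj₁ Sπ)
    Yλ' = Y.filling lam' P' π' (proj₁ Sπ')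
    θ : ℕ → ℕ
    θ x = count x (concat Yλ)
    same-counts : ∀ x → 1 ≤ x → θ x ≡ count x (concat Yλ')
    same-counts (suc x) _ = countUpTo⇒counts (concat Yλ) (concat Yλ') (λ k →
      ≤-antisym (key-countUpTo-≤ lam' lam P' P π' π (proj₁ Sπ') (proj₁ Sπ) (sym ∘ same) k)
                (key-countUpTo-≤ lam lam' P P' π π' (proj₁ Sπ) (proj₁ Sπ') same k)) x
    weight : ∀ i → 1 ≤ i → i ≤ n → θ (at (toList π) i) ≡ at (toList lam) i
    weight = Y.content-key lam P π (proj₁ Sπ)
    weight' : ∀ i → 1 ≤ i → i ≤ n → θ (at (toList π') i) ≡ at (toList lam') i
    weight' i 1≤i i≤n = trans (same-counts _ (proj₁ (PermutationOf.entry-range n (toList π') (proj₁ Sπ') 1≤i i≤n)))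
                              (Y.content-key lam' P' π' (proj₁ Sπ') i 1≤i i≤n)
    same-list : toList π ≡ toList π'
    same-list = WeightOrder.sorted-unique θ (toList π) (toList π')
      (sorted-by-weight lam P π Sπ θ weight) (sorted-by-weight lam' P' π' Sπ' θ weight')
      (↭-trans (proj₁ Sπ) (↭-sym (proj₁ Sπ')))
    π≡π' : π ≡ π'
    π≡π' = toList-injective π π' same-list
    λ≡λ' : lam ≡ lam'
    λ≡λ' = Vec-ext lam lam' (λ i 1≤i i≤n →
      trans (sym (weight i 1≤i i≤n)) (trans (cong (λ p → θ (at p i)) same-list) (weight' i 1≤i i≤n)))

proposition14p1 : (n : ℕ) → 1 ≤ n →
    (lam lam' : Vec ℕ n) → IsPartition lam → IsPartition lam' →
    ((β β' : Vec ℕ n) → InU lam β → InU lam' β' →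
      sPoly lam β ≈Poly sPoly lam' β' → lam ≡ lam')
    × ((π π' : Vec ℕ n) → InSnλ lam π → InSnλ lam' π' →
      dPoly lam π ≈Poly dPoly lam' π' →
      (lam ≡ lam') × (π ≡ π') × (demazureSet lam π ≡ demazureSet lam' π'))
proposition14p1 (suc m) _ lam lam' P P' = part-i , part-ii
  where
  part-i : ∀ β β' → InU lam β → InU lam' β' → sPoly lam β ≈Poly sPoly lam' β' → lam ≡ lam'
  part-i = FlaggedSchur.shape-determined lam lam' P P'

  part-ii : ∀ π π' → InSnλ lam π → InSnλ lam' π' → dPoly lam π ≈Poly dPoly lam' π'
    → (lam ≡ lam') × (π ≡ π') × (demazureSet lam π ≡ demazureSet lam' π')
  part-ii π π' Sπ Sπ' same with Demazure.shape-and-permutation-determined m lam lam' P P' π π' Sπ Sπ' same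
  ... | λ≡λ' , π≡π' = λ≡λ' , π≡π' , cong₂ demazureSet λ≡λ' π≡π'
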